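{- Let $m\geqslant 2$, let $\mathbf{h}=h^m\cdots h^2h^1\in\mathcal{H}^{m,\star}$ and let $1\leqslant i<m$ be such that $f^\star_i(\mathbf{h})\neq 0$. Then $f^\star_i(\mathbf{h})\in\mathcal{H}^{m,\star}$, $f^\star_i(\mathbf{h})\equiv_{\mathcal{H}_0}\mathbf{h}$, $\mathsf{ex}(f^\star_i(\mathbf{h}))=\mathsf{ex}(\mathbf{h})$, and for every $j\notin\{i,i+1\}$ the $j$-th factor of $f^\star_i(\mathbf{h})$ equals the $j$-th factor $h^j$ of $\mathbf{h}$. The analogous statements hold for $e^\star_i$ (whenever $e^\star_i(\mathbf{h})\neq 0$).
   Context: The 0-Hecke monoid $\mathcal{H}_0(n)$ ($n\geqslant1$) is the monoid of finite words in the alphabet $[n-1]=\{1,\dots,n-1\}$ modulo the equivalence $\equiv_{\mathcal{H}_0}$ generated by replacing consecutive subwords via $pq=qp$ if $|p-q|>1$, $pqp=qpq$, and $pp=p$. A word is reduced if it has minimal length in its class; this minimal length is the length $\ell(w)$ of the class $w$. An element (or a word representing it) is fully-commutative if no reduced word equivalent to it contains a consecutive subword $i\,(i+1)\,i$ or $i\,(i-1)\,i$. A decreasing factorization into $m$ factors is a product $\mathbf{h}=h^m\cdots h^2h^1$ where each factor $h^i$ is a (possibly empty) strictly decreasing word; it is a factorization of the element $w\equiv_{\mathcal{H}_0}h^mh^{m-1}\cdots h^1$. Its excess is $\mathsf{ex}(\mathbf{h})=(\text{total number of letters of }\mathbf{h})-\ell(w)$. $\mathcal{H}^{m,\star}$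 is the set of decreasing factorizations into $m$ factors whose element $w$ is fully-commutative. The $\star$-crystal operators on $\mathcal{H}^{m,\star}$: fix $1\leqslant i<m$. Pairing: take the letters $b$ of $h^{i+1}$ in decreasing order; each $b$ is paired with the smallest not-yet-paired letter $a\geqslant b$ of $h^i$, if one exists (otherwise $b$ is unpaired). If all letters of $h^i$ are paired, $f^\star_i(\mathbf{h})=0$. Otherwise let $x$ be the largest unpaired letter of $h^i$: if $x+1$ lies in both $h^i$ and $h^{i+1}$, then $f^\star_i$ removes $x+1$ from $h^i$ and adds $x$ to $h^{i+1}$; otherwise $f^\star_i$ removes $x$ from $h^i$ and adds $x$ to $h^{i+1}$ (factors are kept strictly decreasing). If all letters of $h^{i+1}$ are paired, $e^\star_i(\mathbf{h})=0$. Otherwise let $y$ be the smallest unpaired letter of $h^{i+1}$: if $y-1$ lies in both $h^i$ and $h^{i+1}$, then $e^\star_i$ removes $y-1$ from $h^{i+1}$ and adds $y$ to $h^i$; otherwise $e^\star_i$ removes $y$ from $h^{i+1}$ and adds $y$ to $h^i$. -}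

module Defs where

open import Data.Nat using (ℕ; zero; suc; _+_; _∸_; _≤_; _<_; _⊔_; _⊓_; _≤ᵇ_; _≡ᵇ_)
open import Data.Bool using (Bool; true; false; if_then_else_; _∧_; not)
open import Data.Maybe using (Maybe; just; nothing)
open import Data.List using (List; []; _∷_; _++_; length; concat; reverse; filterᵇ)
open import Data.Bool.ListAction using (any)
open import Data.List.Relation.Unary.All using (All)
open import Data.List.Relation.Unary.Linked using (Linked)
open import Data.Vec using (Vec; toList)
import Data.Vec as V
open import Data.Product using (Σ; ∃; ∃-syntax; _×_; _,_)
open import Data.Sum using (_⊎_)
open import Relation.Binary.PropositionalEquality using (_≡_; _≢_)
open import Relation.Binary.Construct.Closure.Equivalence using (EqClosure)
open import Relation.Nullary using (¬_)
open import Function.Bundles using (_⇔_)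

Word : Set
Word = List ℕ

data Step : Word → Word → Set where
  comm  : ∀ u v p q → (suc (suc p) ≤ q ⊎ suc (suc q) ≤ p) →
          Step (u ++ p ∷ q ∷ v) (u ++ q ∷ p ∷ v)
  braid : ∀ u v p q → (q ≡ suc p ⊎ p ≡ suc q) →
          Step (u ++ p ∷ q ∷ p ∷ v) (u ++ q ∷ p ∷ q ∷ v)
  idem  : ∀ u v p → Step (u ++ p ∷ p ∷ v) (u ++ p ∷ v)

_≈H_ : Word → Word → Set
_≈H_ = EqClosure Step

Reduced : Word → Set
Reduced v = ∀ u → v ≈H u → length v ≤ length u

IsLength : Word → ℕ → Set
IsLength w k = (∃[ v ] (w ≈H v × length v ≡ k)) × (∀ v → w ≈H v → k ≤ length v)

HasBraid : Word → Set
HasBraid v = ∃[ u ] ∃[ t ] ∃[ i ]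
  (v ≡ u ++ i ∷ suc i ∷ i ∷ t ⊎ v ≡ u ++ suc i ∷ i ∷ suc i ∷ t)

FullyCommutative : Word → Set
FullyCommutative w = ∀ v → w ≈H v → Reduced v → ¬ HasBraid v

-- Decreasing factorizations.
-- A factorization h = h^m ⋯ h^1 is a Vec of m words; position 0 holds h^1,
-- position m-1 holds h^m.

Fact : ℕ → Set
Fact m = Vec Word m

word : ∀ {m} → Fact m → Word
word h = concat (reverse (toList h))

total : ∀ {m} → Fact m → ℕ
total h = length (word h)

HasExcess : ∀ {m} → Fact m → ℕ → Set
HasExcess h e = ∃[ k ] (IsLength (word h) k × total h ≡ k + e)

StrictlyDecreasing : Word → Set
StrictlyDecreasing = Linked (λ a b → b < a)

Letter : ℕ → ℕ → Set
Letter n a = 1 ≤ a × a ≤ n ∸ 1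

InHStar : (n m : ℕ) → Fact m → Set
InHStar n m h =
  All (λ f → StrictlyDecreasing f × All (Letter n) f) (toList h) ×
  FullyCommutative (word h)

-- j-th factor h^j (1-based; [] if out of range)
getV : ∀ {m} → ℕ → Vec Word m → Word
getV _       V.[]       = []
getV zero    (x V.∷ _)  = x
getV (suc k) (_ V.∷ xs) = getV k xs

factor : ∀ {m} → ℕ → Fact m → Word
factor j h = getV (j ∸ 1) h

-- replace the (0-based) k-th entry
setV : ∀ {m} → ℕ → Word → Vec Word m → Vec Word m
setV _       _ V.[]       = V.[]
setV zero    w (_ V.∷ xs) = w V.∷ xs
setV (suc k) w (x V.∷ xs) = x V.∷ setV k w xs

mem : ℕ → Word → Bool
mem x = any (λ z → z ≡ᵇ x)

removeL : ℕ → Word → Word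
removeL x = filterᵇ (λ z → not (z ≡ᵇ x))

insertDec : ℕ → Word → Word
insertDec x [] = x ∷ []
insertDec x (y ∷ ys) =
  if y ≡ᵇ x then y ∷ ys
  else if suc y ≤ᵇ x then x ∷ y ∷ ys
  else y ∷ insertDec x ys

maxL : Word → Maybe ℕ
maxL [] = nothing
maxL (a ∷ as) with maxL as
... | nothing = just a
... | just b  = just (a ⊔ b)

minL : Word → Maybe ℕ
minL [] = nothing
minL (a ∷ as) with minL as
... | nothing = just a
... | just b  = just (a ⊓ b)

-- Pairing of h^{i+1} (= B) with h^i (= A).
-- Letters b of B are processed in decreasing order (B is strictly
-- decreasing, so this is list order); each b is paired with the smallest
-- not-yet-paired a ≥ b of A, if any.

pairing : Word → Word → Word × Word
pairing []       avail = [] , avail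
pairing (b ∷ bs) avail with minL (filterᵇ (λ a → b ≤ᵇ a) avail)
... | nothing = let (ub , ua) = pairing bs avail in b ∷ ub , ua
... | just a  = pairing bs (removeL a avail)

unpairedB : Word → Word → Word
unpairedB B A with pairing B A
... | (ub , _) = ub

unpairedA : Word → Word → Word
unpairedA B A with pairing B A
... | (_ , ua) = ua

fPair : Word → Word → Maybe (Word × Word)
fPair B A with maxL (unpairedA B A)
... | nothing = nothing
... | just x  =
  if mem (suc x) A ∧ mem (suc x) B
  then just (insertDec x B , removeL (suc x) A)
  else just (insertDec x B , removeL x A)

ePair : Word → Word → Maybe (Word × Word)
ePair B A with minL (unpairedB B A)
... | nothing = nothing
... | just y  =
  if mem (y ∸ 1) A ∧ mem (y ∸ 1) B
  then just (removeL (y ∸ 1) B , insertDec y A)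
  else just (removeL y B , insertDec y A)

-- apply a pair operation to factors h^{i+1}, h^i (positions i, i-1)
applyAt : ∀ {m} → (Word → Word → Maybe (Word × Word)) → ℕ → Fact m → Maybe (Fact m)
applyAt op i h with op (factor (suc i) h) (factor i h)
... | nothing       = nothing
... | just (B' , A') = just (setV i B' (setV (i ∸ 1) A' h))

-- f⋆_i and e⋆_i  (nothing represents 0)
fStar : ∀ {m} → ℕ → Fact m → Maybe (Fact m)
fStar = applyAt fPair

eStar : ∀ {m} → ℕ → Fact m → Maybe (Fact m)
eStar = applyAt ePair

Conclusion : (n m i : ℕ) → Fact m → Fact m → Set
Conclusion n m i h h' =
  InHStar n m h' ×
  word h' ≈H word h ×
  (∀ e → HasExcess h' e ⇔ HasExcess h e) ×
  (∀ j → 1 ≤ j → j ≤ m → j ≢ i → j ≢ suc i → factor j h' ≡ factor j h)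

-- f⋆_i and e⋆_i only change the factors B = h^{i+1} and A = h^i: one letter x moves across the
-- boundary between them, and when x+1 lies in both factors, x+1 is traded for x.  The element
-- is unchanged because x commutes with every letter it passes (and, when trading, the relation
-- pp = p absorbs the duplicate); the remaining claims are bookkeeping on decreasing words.
-- The commutations need the passed letters to differ from x by at least 2.  The pairing and
-- full commutativity exclude the neighbours x ± 1 (and x + 2 when trading): a neighbour not
-- excluded by the pairing would produce, after commuting, a braid factor p(p+1)p or (p+1)p(p+1)
-- in a word equivalent to h, and such a word reduces around that factor to a reduced word still
-- containing it.  Reducedness is certified by the action of the monoid on sequences in which the
-- letter q sorts the entries at q and q+1 decreasingly: a word all of whose letters act at
-- ascents of the identity sequence is reduced.
module Submission where

open import Defs
open import Data.Bool using (true; false; not; T; _∧_)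
open import Data.Empty using (⊥; ⊥-elim)
open import Data.List using (List; []; _∷_; _++_; [_]; _∷ʳ_; length; concat; reverse; filterᵇ)
open import Data.List.Properties
  using (++-assoc; ++-identityʳ; length-++; length-++-sucʳ; reverse-++; filter-accept; filter-reject; filter-all)
open import Data.List.Relation.Unary.All as All using (All; []; _∷_)
import Data.List.Relation.Unary.All.Properties as All
open import Data.List.Relation.Unary.AllPairs as AllPairs using (AllPairs; []; _∷_)
import Data.List.Relation.Unary.AllPairs.Properties as AllPairs
open import Data.List.Relation.Unary.Any as Any using (here; there)
open import Data.List.Relation.Unary.Any.Properties using (any⁻; any⁺; ¬Any[])
open import Data.List.Relation.Unary.Linked.Properties using (Linked⇒AllPairs; AllPairs⇒Linked)
open import Data.List.Reverse using (Reverse; []; _∶_∶ʳ_; reverseView)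
open import Data.Maybe using (Maybe; just; nothing)
open import Data.Nat using (ℕ; zero; suc; _+_; _∸_; _≤_; _<_; _⊔_; _⊓_; _≡ᵇ_; _≤ᵇ_; _≟_; _<?_; z≤n; s≤s)
open import Data.Nat.Properties
open import Data.List.Membership.Propositional using (_∈_; _∉_)
open import Data.List.Membership.Propositional.Properties using (∈-filter⁺; ∈-filter⁻)
open import Data.List.Membership.DecPropositional _≟_ using (_∈?_)
open import Data.Product using (Σ-syntax; ∃; ∃₂; _×_; _,_; proj₁; proj₂)
open import Data.Sum using (_⊎_; inj₁; inj₂)
open import Data.Unit using (⊤; tt)
open import Data.Vec using (Vec; toList) renaming ([] to []ᵛ; _∷_ to _∷ᵛ_)
open import Function.Base using (id; _∘_; case_of_)
open import Function.Bundles using (_⇔_; mk⇔)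
open import Relation.Binary.Bundles using (Setoid)
open import Relation.Binary.Definitions using (tri<; tri≈; tri>)
open import Relation.Binary.PropositionalEquality
  using (_≡_; _≢_; refl; sym; trans; cong; cong₂; subst; subst₂; ≢-sym; _≗_; _→-setoid_; module ≡-Reasoning; cong-app)
import Relation.Binary.Construct.Closure.Equivalence as EqClosure
import Relation.Binary.Reasoning.Setoid as SetoidReasoning
open import Relation.Nullary using (¬_; yes; no; contradiction)
open import Relation.Nullary.Decidable using (T?)
open import Relation.Nullary.Reflects using (Reflects; ofʸ; ofⁿ; fromEquivalence; _×-reflects_)

≈H-setoid : Setoid _ _
≈H-setoid = EqClosure.setoid Step

open Setoid ≈H-setoid
  using () renaming (refl to ≈H-refl; sym to ≈H-sym; trans to ≈H-trans; reflexive to ≈H-reflexive)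

module ≈H-Reasoning = SetoidReasoning ≈H-setoid

≈H-return : ∀ {u v} → Step u v → u ≈H v
≈H-return = EqClosure.return

Step-++ˡ : ∀ w {u v} → Step u v → Step (w ++ u) (w ++ v)
Step-++ˡ w (comm u v p q far)
  rewrite sym (++-assoc w u (p ∷ q ∷ v)) | sym (++-assoc w u (q ∷ p ∷ v)) = comm (w ++ u) v p q far
Step-++ˡ w (braid u v p q adj)
  rewrite sym (++-assoc w u (p ∷ q ∷ p ∷ v)) | sym (++-assoc w u (q ∷ p ∷ q ∷ v)) = braid (w ++ u) v p q adj
Step-++ˡ w (idem u v p)
  rewrite sym (++-assoc w u (p ∷ p ∷ v)) | sym (++-assoc w u (p ∷ v)) = idem (w ++ u) v p

Step-++ʳ : ∀ w {u v} → Step u v → Step (u ++ w) (v ++ w)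
Step-++ʳ w (comm u v p q far)
  rewrite ++-assoc u (p ∷ q ∷ v) w | ++-assoc u (q ∷ p ∷ v) w = comm u (v ++ w) p q far
Step-++ʳ w (braid u v p q adj)
  rewrite ++-assoc u (p ∷ q ∷ p ∷ v) w | ++-assoc u (q ∷ p ∷ q ∷ v) w = braid u (v ++ w) p q adj
Step-++ʳ w (idem u v p)
  rewrite ++-assoc u (p ∷ p ∷ v) w | ++-assoc u (p ∷ v) w = idem u (v ++ w) p

≈H-++ˡ : ∀ w {u v} → u ≈H v → (w ++ u) ≈H (w ++ v)
≈H-++ˡ w = EqClosure.gmap (w ++_) (Step-++ˡ w)

≈H-++ʳ : ∀ w {u v} → u ≈H v → (u ++ w) ≈H (v ++ w)
≈H-++ʳ w = EqClosure.gmap (_++ w) (Step-++ʳ w)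

≈H-∷ : ∀ a {u v} → u ≈H v → (a ∷ u) ≈H (a ∷ v)
≈H-∷ a = ≈H-++ˡ [ a ]

Far : ℕ → ℕ → Set
Far p q = suc (suc p) ≤ q ⊎ suc (suc q) ≤ p

Far-sym : ∀ {p q} → Far p q → Far q p
Far-sym (inj₁ le) = inj₂ le
Far-sym (inj₂ le) = inj₁ le

Far-below : ∀ {c z} → z < c → suc z ≢ c → Far c z
Far-below z<c 1+z≢c = inj₂ (≤∧≢⇒< z<c 1+z≢c)

Far-above : ∀ {c z} → c < z → z ≢ suc c → Far c z
Far-above c<z z≢1+c = inj₁ (≤∧≢⇒< c<z (z≢1+c ∘ sym))

All-Far-below : ∀ {c W} → All (_< c) W → All (λ z → suc z ≢ c) W → All (Far c) W
All-Far-below below apart = All.zipWith (λ (z<c , 1+z≢c) → Far-below z<c 1+z≢c) (below , apart)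

All-Far-above : ∀ {c W} → All (c <_) W → All (_≢ suc c) W → All (Far c) W
All-Far-above above apart = All.zipWith (λ (c<z , z≢1+c) → Far-above c<z z≢1+c) (above , apart)

≈H-comm : ∀ {p q} → Far p q → (p ∷ q ∷ []) ≈H (q ∷ p ∷ [])
≈H-comm {p} {q} far = ≈H-return (comm [] [] p q far)

≈H-idem : ∀ p → (p ∷ p ∷ []) ≈H (p ∷ [])
≈H-idem p = ≈H-return (idem [] [] p)

≈H-braid : ∀ p → (p ∷ suc p ∷ p ∷ []) ≈H (suc p ∷ p ∷ suc p ∷ [])
≈H-braid p = ≈H-return (braid [] [] p (suc p) (inj₁ refl))

≈H-commutes-past : ∀ {c} W R → All (Far c) W → (c ∷ W ++ R) ≈H (W ++ c ∷ R)
≈H-commutes-past     []      R []           = ≈H-refl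
≈H-commutes-past {c} (w ∷ W) R (far ∷ fars) = begin
  c ∷ w ∷ W ++ R   ≈⟨ ≈H-++ʳ (W ++ R) (≈H-comm far) ⟩
  w ∷ c ∷ W ++ R   ≈⟨ ≈H-∷ w (≈H-commutes-past W R fars) ⟩
  w ∷ W ++ c ∷ R   ∎
  where open ≈H-Reasoning

-- The action of the 0-Hecke monoid on sequences by sorting adjacent entries

Seq : Set
Seq = ℕ → ℕ

open Setoid (ℕ →-setoid ℕ)
  using () renaming (isEquivalence to ≗-isEquivalence; sym to ≗-sym; trans to ≗-trans)

module ≗-Reasoning = SetoidReasoning (ℕ →-setoid ℕ)

sortAt : Seq → ℕ → Seq
sortAt π q k with k ≟ q | k ≟ suc q
... | yes _ | _     = π q ⊔ π (suc q)
... | no _  | yes _ = π q ⊓ π (suc q)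
... | no _  | no _  = π k

act : Seq → Word → Seq
act π []      = π
act π (a ∷ w) = act (sortAt π a) w

data Position (q : ℕ) : ℕ → Set where
  at-q   : Position q q
  at-1+q : Position q (suc q)
  away   : ∀ {k} → k ≢ q → k ≢ suc q → Position q k

position : ∀ q k → Position q k
position q k with k ≟ q | k ≟ suc q
... | yes refl | _        = at-q
... | no _     | yes refl = at-1+q
... | no k≢q   | no k≢1+q = away k≢q k≢1+q

n≢1+n : ∀ n → n ≢ suc n
n≢1+n n = <⇒≢ (n<1+n n)

n≢2+n : ∀ n → n ≢ suc (suc n)
n≢2+n n = <⇒≢ (<-trans (n<1+n n) (n<1+n (suc n)))

sortAt-at : ∀ π q → sortAt π q q ≡ π q ⊔ π (suc q)
sortAt-at π q with q ≟ q
... | yes _ = refl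
... | no q≢q = ⊥-elim (q≢q refl)

sortAt-suc : ∀ π q → sortAt π q (suc q) ≡ π q ⊓ π (suc q)
sortAt-suc π q with suc q ≟ q | suc q ≟ suc q
... | yes 1+q≡q | _ = ⊥-elim (n≢1+n q (sym 1+q≡q))
... | no _ | yes _ = refl
... | no _ | no 1+q≢1+q = ⊥-elim (1+q≢1+q refl)

sortAt-other : ∀ π q {k} → k ≢ q → k ≢ suc q → sortAt π q k ≡ π k
sortAt-other π q {k} k≢q k≢1+q with k ≟ q | k ≟ suc q
... | yes k≡q | _ = ⊥-elim (k≢q k≡q)
... | no _ | yes k≡1+q = ⊥-elim (k≢1+q k≡1+q)
... | no _ | no _ = refl

sortAt-below : ∀ π q → sortAt π (suc q) q ≡ π q
sortAt-below π q = sortAt-other π (suc q) (n≢1+n q) (n≢2+n q)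

sortAt-above : ∀ π q → sortAt π q (suc (suc q)) ≡ π (suc (suc q))
sortAt-above π q = sortAt-other π q (≢-sym (n≢2+n q)) (≢-sym (n≢1+n (suc q)))

sortAt-cong : ∀ {π σ} q → π ≗ σ → sortAt π q ≗ sortAt σ q
sortAt-cong q π≗σ k with k ≟ q | k ≟ suc q
... | yes _ | _     = cong₂ _⊔_ (π≗σ q) (π≗σ (suc q))
... | no _  | yes _ = cong₂ _⊓_ (π≗σ q) (π≗σ (suc q))
... | no _  | no _  = π≗σ k

act-cong : ∀ {π σ} w → π ≗ σ → act π w ≗ act σ w
act-cong []      π≗σ = π≗σ
act-cong (a ∷ w) π≗σ = act-cong w (sortAt-cong a π≗σ)

act-++ : ∀ π u v → act π (u ++ v) ≡ act (act π u) v
act-++ π []      v = refl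
act-++ π (a ∷ u) v = act-++ (sortAt π a) u v

sortAt-idem : ∀ σ p → sortAt (sortAt σ p) p ≗ sortAt σ p
sortAt-idem σ p k with position p k
... | at-q = trans (sortAt-at (sortAt σ p) p) (trans (cong₂ _⊔_ (sortAt-at σ p) (sortAt-suc σ p))
               (trans (m≥n⇒m⊔n≡m (m⊓n≤m⊔n (σ p) (σ (suc p)))) (sym (sortAt-at σ p))))
... | at-1+q = trans (sortAt-suc (sortAt σ p) p) (trans (cong₂ _⊓_ (sortAt-at σ p) (sortAt-suc σ p))
                       (trans (⊓-comm _ _) (trans (m≤n⇒m⊓n≡m (m⊓n≤m⊔n (σ p) (σ (suc p)))) (sym (sortAt-suc σ p)))))
... | away k≢p k≢1+p = sortAt-other (sortAt σ p) p k≢p k≢1+p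

-- The three entries at p, p+1, p+2 end up sorted either way; these identities say that
-- the maximum, the middle and the minimum computed along the two words agree.
sorted-max : ∀ a b c → (a ⊔ b) ⊔ ((a ⊓ b) ⊔ c) ≡ a ⊔ (b ⊔ c)
sorted-max a b zero rewrite ⊔-identityʳ (a ⊓ b) | ⊔-identityʳ b = m≥n⇒m⊔n≡m (m⊓n≤m⊔n a b)
sorted-max zero b (suc c) = refl
sorted-max (suc a) zero (suc c) = refl
sorted-max (suc a) (suc b) (suc c) = cong suc (sorted-max a b c)

sorted-mid : ∀ a b c → (a ⊔ b) ⊓ ((a ⊓ b) ⊔ c) ≡ (a ⊓ (b ⊔ c)) ⊔ (b ⊓ c)
sorted-mid a b zero rewrite ⊔-identityʳ (a ⊓ b) | ⊔-identityʳ b | ⊓-zeroʳ b | ⊔-identityʳ (a ⊓ b) =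
  trans (⊓-comm (a ⊔ b) (a ⊓ b)) (m≤n⇒m⊓n≡m (m⊓n≤m⊔n a b))
sorted-mid zero b (suc c) = refl
sorted-mid (suc a) zero (suc c) = refl
sorted-mid (suc a) (suc b) (suc c) = cong suc (sorted-mid a b c)

sorted-min : ∀ a b c → (a ⊓ b) ⊓ c ≡ (a ⊓ (b ⊔ c)) ⊓ (b ⊓ c)
sorted-min a b zero rewrite ⊓-zeroʳ (a ⊓ b) | ⊓-zeroʳ b | ⊓-zeroʳ (a ⊓ (b ⊔ 0)) = refl
sorted-min zero b (suc c) = refl
sorted-min (suc a) zero (suc c) = refl
sorted-min (suc a) (suc b) (suc c) = cong suc (sorted-min a b c)

module _ (σ : Seq) (p : ℕ) where
  private
    a = σ p
    b = σ (suc p)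
    c = σ (suc (suc p))
    f₁ = sortAt σ p
    f₂ = sortAt f₁ (suc p)
    g₁ = sortAt σ (suc p)
    g₂ = sortAt g₁ p

    f₁-1 : f₁ (suc p) ≡ a ⊓ b
    f₁-1 = sortAt-suc σ p
    f₁-2 : f₁ (suc (suc p)) ≡ c
    f₁-2 = sortAt-above σ p
    f₂-0 : f₂ p ≡ a ⊔ b
    f₂-0 = trans (sortAt-below f₁ p) (sortAt-at σ p)
    f₂-1 : f₂ (suc p) ≡ (a ⊓ b) ⊔ c
    f₂-1 = trans (sortAt-at f₁ (suc p)) (cong₂ _⊔_ f₁-1 f₁-2)
    f₂-2 : f₂ (suc (suc p)) ≡ (a ⊓ b) ⊓ c
    f₂-2 = trans (sortAt-suc f₁ (suc p)) (cong₂ _⊓_ f₁-1 f₁-2)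
    g₁-0 : g₁ p ≡ a
    g₁-0 = sortAt-below σ p
    g₂-0 : g₂ p ≡ a ⊔ (b ⊔ c)
    g₂-0 = trans (sortAt-at g₁ p) (cong₂ _⊔_ g₁-0 (sortAt-at σ (suc p)))
    g₂-1 : g₂ (suc p) ≡ a ⊓ (b ⊔ c)
    g₂-1 = trans (sortAt-suc g₁ p) (cong₂ _⊓_ g₁-0 (sortAt-at σ (suc p)))
    g₂-2 : g₂ (suc (suc p)) ≡ b ⊓ c
    g₂-2 = trans (sortAt-above g₁ p) (sortAt-suc σ (suc p))

  sortAt-braid : sortAt (sortAt (sortAt σ p) (suc p)) p ≗ sortAt (sortAt (sortAt σ (suc p)) p) (suc p)
  sortAt-braid k with position p k
  ... | at-q = begin
    sortAt f₂ p p                    ≡⟨ sortAt-at f₂ p ⟩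
    f₂ p ⊔ f₂ (suc p)                ≡⟨ cong₂ _⊔_ f₂-0 f₂-1 ⟩
    (a ⊔ b) ⊔ ((a ⊓ b) ⊔ c)          ≡⟨ sorted-max a b c ⟩
    a ⊔ (b ⊔ c)                      ≡⟨ sym g₂-0 ⟩
    g₂ p                             ≡⟨ sortAt-below g₂ p ⟨
    sortAt g₂ (suc p) p              ∎
    where open ≡-Reasoning
  ... | at-1+q = begin
    sortAt f₂ p (suc p)              ≡⟨ sortAt-suc f₂ p ⟩
    f₂ p ⊓ f₂ (suc p)                ≡⟨ cong₂ _⊓_ f₂-0 f₂-1 ⟩
    (a ⊔ b) ⊓ ((a ⊓ b) ⊔ c)          ≡⟨ sorted-mid a b c ⟩
    (a ⊓ (b ⊔ c)) ⊔ (b ⊓ c)          ≡⟨ cong₂ _⊔_ g₂-1 g₂-2 ⟨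
    g₂ (suc p) ⊔ g₂ (suc (suc p))    ≡⟨ sortAt-at g₂ (suc p) ⟨
    sortAt g₂ (suc p) (suc p)        ∎
    where open ≡-Reasoning
  ... | away k≢p k≢1+p with position (suc p) k
  ...   | at-q = ⊥-elim (k≢1+p refl)
  ...   | at-1+q = begin
    sortAt f₂ p (suc (suc p))        ≡⟨ sortAt-above f₂ p ⟩
    f₂ (suc (suc p))                 ≡⟨ f₂-2 ⟩
    (a ⊓ b) ⊓ c                      ≡⟨ sorted-min a b c ⟩
    (a ⊓ (b ⊔ c)) ⊓ (b ⊓ c)          ≡⟨ cong₂ _⊓_ g₂-1 g₂-2 ⟨
    g₂ (suc p) ⊓ g₂ (suc (suc p))    ≡⟨ sortAt-suc g₂ (suc p) ⟨
    sortAt g₂ (suc p) (suc (suc p))  ∎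
    where open ≡-Reasoning
  ...   | away _ k≢2+p = begin
    sortAt f₂ p k                    ≡⟨ sortAt-other f₂ p k≢p k≢1+p ⟩
    f₂ k                             ≡⟨ sortAt-other f₁ (suc p) k≢1+p k≢2+p ⟩
    f₁ k                             ≡⟨ sortAt-other σ p k≢p k≢1+p ⟩
    σ k                              ≡⟨ sortAt-other σ (suc p) k≢1+p k≢2+p ⟨
    g₁ k                             ≡⟨ sortAt-other g₁ p k≢p k≢1+p ⟨
    g₂ k                             ≡⟨ sortAt-other g₂ (suc p) k≢1+p k≢2+p ⟨
    sortAt g₂ (suc p) k              ∎
    where open ≡-Reasoning

Far⇒≢ : ∀ {p q} → Far p q → p ≢ q × p ≢ suc q × suc p ≢ q × suc p ≢ suc q
Far⇒≢ {p} (inj₁ 1+p<q) = <⇒≢ p<q , <⇒≢ (m<n⇒m<1+n p<q) , <⇒≢ 1+p<q , <⇒≢ (s≤s p<q)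
  where p<q = <-trans (n<1+n p) 1+p<q
Far⇒≢ {q = q} (inj₂ 1+q<p) = >⇒≢ q<p , >⇒≢ 1+q<p , >⇒≢ (m<n⇒m<1+n q<p) , >⇒≢ (s≤s q<p)
  where q<p = <-trans (n<1+n q) 1+q<p

sortAt-far : ∀ σ {p q} → Far p q → sortAt σ q p ≡ σ p
sortAt-far σ {q = q} far = let (p≢q , p≢1+q , _) = Far⇒≢ far in sortAt-other σ q p≢q p≢1+q

sortAt-far-suc : ∀ σ {p q} → Far p q → sortAt σ q (suc p) ≡ σ (suc p)
sortAt-far-suc σ {q = q} far = let (_ , _ , 1+p≢q , 1+p≢1+q) = Far⇒≢ far in sortAt-other σ q 1+p≢q 1+p≢1+q

sortAt-comm-near : ∀ σ {p q} → Far p q → ∀ {k} → k ≡ p ⊎ k ≡ suc p →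
                   sortAt (sortAt σ p) q k ≡ sortAt (sortAt σ q) p k
sortAt-comm-near σ {p} {q} far (inj₁ refl) = begin
  sortAt (sortAt σ p) q p               ≡⟨ sortAt-far (sortAt σ p) far ⟩
  sortAt σ p p                          ≡⟨ sortAt-at σ p ⟩
  σ p ⊔ σ (suc p)                       ≡⟨ cong₂ _⊔_ (sortAt-far σ far) (sortAt-far-suc σ far) ⟨
  sortAt σ q p ⊔ sortAt σ q (suc p)     ≡⟨ sortAt-at (sortAt σ q) p ⟨
  sortAt (sortAt σ q) p p               ∎
  where open ≡-Reasoning
sortAt-comm-near σ {p} {q} far (inj₂ refl) = begin
  sortAt (sortAt σ p) q (suc p)         ≡⟨ sortAt-far-suc (sortAt σ p) far ⟩
  sortAt σ p (suc p)                    ≡⟨ sortAt-suc σ p ⟩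
  σ p ⊓ σ (suc p)                       ≡⟨ cong₂ _⊓_ (sortAt-far σ far) (sortAt-far-suc σ far) ⟨
  sortAt σ q p ⊓ sortAt σ q (suc p)     ≡⟨ sortAt-suc (sortAt σ q) p ⟨
  sortAt (sortAt σ q) p (suc p)         ∎
  where open ≡-Reasoning

sortAt-comm : ∀ σ {p q} → Far p q → sortAt (sortAt σ p) q ≗ sortAt (sortAt σ q) p
sortAt-comm σ {p} {q} far k with position p k | position q k
... | at-q   | _      = sortAt-comm-near σ far (inj₁ refl)
... | at-1+q | _      = sortAt-comm-near σ far (inj₂ refl)
... | away _ _ | at-q   = sym (sortAt-comm-near σ (Far-sym far) (inj₁ refl))
... | away _ _ | at-1+q = sym (sortAt-comm-near σ (Far-sym far) (inj₂ refl))
... | away k≢p k≢1+p | away k≢q k≢1+q = begin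
  sortAt (sortAt σ p) q k   ≡⟨ sortAt-other (sortAt σ p) q k≢q k≢1+q ⟩
  sortAt σ p k              ≡⟨ sortAt-other σ p k≢p k≢1+p ⟩
  σ k                       ≡⟨ sortAt-other σ q k≢q k≢1+q ⟨
  sortAt σ q k              ≡⟨ sortAt-other (sortAt σ q) p k≢p k≢1+p ⟨
  sortAt (sortAt σ q) p k   ∎
  where open ≡-Reasoning

act-step : ∀ π {u v} → Step u v → act π u ≗ act π v
act-step π (comm u v p q far)
  rewrite act-++ π u (p ∷ q ∷ v) | act-++ π u (q ∷ p ∷ v) = act-cong v (sortAt-comm (act π u) far)
act-step π (braid u v p .(suc p) (inj₁ refl))
  rewrite act-++ π u (p ∷ suc p ∷ p ∷ v) | act-++ π u (suc p ∷ p ∷ suc p ∷ v) = act-cong v (sortAt-braid (act π u) p)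
act-step π (braid u v .(suc q) q (inj₂ refl))
  rewrite act-++ π u (suc q ∷ q ∷ suc q ∷ v) | act-++ π u (q ∷ suc q ∷ q ∷ v) =
    act-cong v (≗-sym (sortAt-braid (act π u) q))
act-step π (idem u v p)
  rewrite act-++ π u (p ∷ p ∷ v) | act-++ π u (p ∷ v) = act-cong v (sortAt-idem (act π u) p)

act-resp-≈H : ∀ π {u v} → u ≈H v → act π u ≗ act π v
act-resp-≈H π = EqClosure.gfold ≗-isEquivalence (act π) (act-step π)

-- Ascent words, the exchange property and fully-commutative words

Ascent : Seq → ℕ → Set
Ascent π q = π q < π (suc q)

Descent : Seq → ℕ → Set
Descent π q = π (suc q) ≤ π q

Increasing : Seq → Set
Increasing π = ∀ q → Ascent π q

ascent? : ∀ π q → Ascent π q ⊎ Descent π q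
ascent? π q with π q <? π (suc q)
... | yes asc  = inj₁ asc
... | no ¬asc = inj₂ (≮⇒≥ ¬asc)

Ascent-cong : ∀ {π σ} q → π ≗ σ → Ascent π q → Ascent σ q
Ascent-cong q π≗σ = subst₂ _<_ (π≗σ q) (π≗σ (suc q))

Descent-cong : ∀ {π σ} q → π ≗ σ → Descent π q → Descent σ q
Descent-cong q π≗σ = subst₂ _≤_ (π≗σ (suc q)) (π≗σ q)

AscentWord : Seq → Word → Set
AscentWord π []      = ⊤
AscentWord π (a ∷ w) = Ascent π a × AscentWord (sortAt π a) w

AscentWord-++⁺ : ∀ π u {v} → AscentWord π u → AscentWord (act π u) v → AscentWord π (u ++ v)
AscentWord-++⁺ π []      _            ascs′ = ascs′
AscentWord-++⁺ π (a ∷ u) (asc , ascs) ascs′ = asc , AscentWord-++⁺ (sortAt π a) u ascs ascs′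

AscentWord-++⁻ : ∀ π u {v} → AscentWord π (u ++ v) → AscentWord π u × AscentWord (act π u) v
AscentWord-++⁻ π []      ascs         = tt , ascs
AscentWord-++⁻ π (a ∷ u) (asc , ascs) =
  let (ascs₁ , ascs₂) = AscentWord-++⁻ (sortAt π a) u ascs in (asc , ascs₁) , ascs₂

act-∷ʳ : ∀ π u a → act π (u ∷ʳ a) ≡ sortAt (act π u) a
act-∷ʳ π u a = act-++ π u [ a ]

AscentWord-∷ʳ⁺ : ∀ π u {a} → AscentWord π u → Ascent (act π u) a → AscentWord π (u ∷ʳ a)
AscentWord-∷ʳ⁺ π u ascs asc = AscentWord-++⁺ π u ascs (asc , tt)

AscentWord-∷ʳ⁻ : ∀ π u {a} → AscentWord π (u ∷ʳ a) → AscentWord π u × Ascent (act π u) a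
AscentWord-∷ʳ⁻ π u ascs = let (ascs₁ , asc , _) = AscentWord-++⁻ π u ascs in ascs₁ , asc

length-∷ʳ : ∀ (u : Word) a → length (u ∷ʳ a) ≡ suc (length u)
length-∷ʳ u a = trans (length-++ u) (+-comm (length u) 1)

sortAt-ascent-at : ∀ π q → Ascent π q → sortAt π q q ≡ π (suc q)
sortAt-ascent-at π q asc = trans (sortAt-at π q) (m≤n⇒m⊔n≡n (<⇒≤ asc))

sortAt-ascent-suc : ∀ π q → Ascent π q → sortAt π q (suc q) ≡ π q
sortAt-ascent-suc π q asc = trans (sortAt-suc π q) (m≤n⇒m⊓n≡m (<⇒≤ asc))

sortAt-descent : ∀ π q → Descent (sortAt π q) q
sortAt-descent π q rewrite sortAt-at π q | sortAt-suc π q = m⊓n≤m⊔n (π q) (π (suc q))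

act-∷ʳ-descent : ∀ π u q → Descent (act π (u ∷ʳ q)) q
act-∷ʳ-descent π u q rewrite act-∷ʳ π u q = sortAt-descent (act π u) q

sortAt-descent-fixed : ∀ π q → Descent π q → sortAt π q ≗ π
sortAt-descent-fixed π q desc k with position q k
... | at-q           = trans (sortAt-at π q) (m≥n⇒m⊔n≡m desc)
... | at-1+q         = trans (sortAt-suc π q) (m≥n⇒m⊓n≡n desc)
... | away k≢q k≢1+q = sortAt-other π q k≢q k≢1+q

sortAt-ascent-injective : ∀ π σ q → Ascent π q → Ascent σ q → sortAt π q ≗ sortAt σ q → π ≗ σ
sortAt-ascent-injective π σ q ascπ ascσ eq k with position q k
... | at-q   = trans (sym (sortAt-ascent-suc π q ascπ)) (trans (eq (suc q)) (sortAt-ascent-suc σ q ascσ))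
... | at-1+q = trans (sym (sortAt-ascent-at π q ascπ)) (trans (eq q) (sortAt-ascent-at σ q ascσ))
... | away k≢q k≢1+q = trans (sym (sortAt-other π q k≢q k≢1+q)) (trans (eq k) (sortAt-other σ q k≢q k≢1+q))

module _ (π : Seq) {s a : ℕ} (far : Far s a) where

  Descent-far⁻ : Descent (sortAt π a) s → Descent π s
  Descent-far⁻ rewrite sortAt-far π far | sortAt-far-suc π far = id

  Ascent-far⁻ : Ascent (sortAt π a) s → Ascent π s
  Ascent-far⁻ rewrite sortAt-far π far | sortAt-far-suc π far = id

  Ascent-far⁺ : Ascent π s → Ascent (sortAt π a) s
  Ascent-far⁺ rewrite sortAt-far π far | sortAt-far-suc π far = id

Adjacent : ℕ → ℕ → Set
Adjacent s t = t ≡ suc s ⊎ s ≡ suc t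

Adjacent-sym : ∀ {s t} → Adjacent s t → Adjacent t s
Adjacent-sym (inj₁ t≡1+s) = inj₂ t≡1+s
Adjacent-sym (inj₂ s≡1+t) = inj₁ s≡1+t

Far-or-Adjacent : ∀ a s → a ≢ s → Far a s ⊎ Adjacent s a
Far-or-Adjacent a s a≢s with <-cmp a s
... | tri≈ _ a≡s _ = ⊥-elim (a≢s a≡s)
... | tri< a<s _ _ with suc a ≟ s
...   | yes 1+a≡s = inj₂ (inj₂ (sym 1+a≡s))
...   | no 1+a≢s  = inj₁ (inj₁ (≤∧≢⇒< a<s 1+a≢s))
Far-or-Adjacent a s a≢s | tri> _ _ s<a with suc s ≟ a
...   | yes 1+s≡a = inj₂ (inj₁ (sym 1+s≡a))
...   | no 1+s≢a  = inj₁ (inj₂ (≤∧≢⇒< s<a 1+s≢a))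

record AdjacentLetters (s t : ℕ) : Set where
  field
    descent-pullback  : ∀ σ → Ascent σ t → Descent (sortAt σ t) s → Descent σ s
    descent-pullback₂ : ∀ τ → Ascent τ s → Ascent (sortAt τ s) t → Descent (act τ (s ∷ t ∷ [])) s → Descent τ t
    braid-ascent      : ∀ ρ → AscentWord ρ (t ∷ s ∷ t ∷ []) → AscentWord ρ (s ∷ t ∷ s ∷ [])
    braid-word        : (t ∷ s ∷ t ∷ []) ≈H (s ∷ t ∷ s ∷ [])

  braid-act : ∀ ρ → act ρ (s ∷ t ∷ s ∷ []) ≗ act ρ (t ∷ s ∷ t ∷ [])
  braid-act ρ = act-resp-≈H ρ (≈H-sym braid-word)

-- Either braid word is an ascent word at ρ exactly when ρ increases on the three positions involved.
private
  adjacent-up : ∀ s → AdjacentLetters s (suc s)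
  adjacent-up s = record
    { descent-pullback = λ σ asc desc → ≤-trans (<⇒≤ asc)
        (subst₂ _≤_ (sortAt-ascent-at σ (suc s) asc) (sortAt-below σ s) desc)
    ; descent-pullback₂ = λ τ asc asc′ desc →
        subst₂ _≤_ (trans (sortAt-ascent-at (sortAt τ s) (suc s) asc′) (sortAt-above τ s))
                   (trans (sortAt-below (sortAt τ s) s) (sortAt-ascent-at τ s asc)) desc
    ; braid-ascent = braid-ascent-up
    ; braid-word = ≈H-sym (≈H-braid s)
    }
    where
    braid-ascent-up : ∀ ρ → AscentWord ρ (suc s ∷ s ∷ suc s ∷ []) → AscentWord ρ (s ∷ suc s ∷ s ∷ [])
    braid-ascent-up ρ (asc₁ , asc₂ , asc₃ , _) = ρs<ρ1+s , ρ′-asc , ρ″-asc , tt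
      where
      ρs<ρ2+s : ρ s < ρ (suc (suc s))
      ρs<ρ2+s = subst₂ _<_ (sortAt-below ρ s) (sortAt-ascent-at ρ (suc s) asc₁) asc₂
      ρs<ρ1+s : ρ s < ρ (suc s)
      ρs<ρ1+s = subst₂ _<_
        (trans (sortAt-ascent-suc (sortAt ρ (suc s)) s asc₂) (sortAt-below ρ s))
        (trans (sortAt-above (sortAt ρ (suc s)) s) (sortAt-ascent-suc ρ (suc s) asc₁)) asc₃
      ρ′-asc : Ascent (sortAt ρ s) (suc s)
      ρ′-asc = subst₂ _<_ (sym (sortAt-ascent-suc ρ s ρs<ρ1+s)) (sym (sortAt-above ρ s)) ρs<ρ2+s
      ρ″-asc : Ascent (sortAt (sortAt ρ s) (suc s)) s
      ρ″-asc = subst₂ _<_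
        (sym (trans (sortAt-below (sortAt ρ s) s) (sortAt-ascent-at ρ s ρs<ρ1+s)))
        (sym (trans (sortAt-ascent-at (sortAt ρ s) (suc s) ρ′-asc) (sortAt-above ρ s))) asc₁

  adjacent-down : ∀ t → AdjacentLetters (suc t) t
  adjacent-down t = record
    { descent-pullback = λ σ asc desc → ≤-trans
        (subst₂ _≤_ (sortAt-above σ t) (sortAt-ascent-suc σ t asc) desc) (<⇒≤ asc)
    ; descent-pullback₂ = λ τ asc asc′ desc →
        subst₂ _≤_ (trans (sortAt-above (sortAt τ (suc t)) t) (sortAt-ascent-suc τ (suc t) asc))
                   (trans (sortAt-ascent-suc (sortAt τ (suc t)) t asc′) (sortAt-below τ t)) desc
    ; braid-ascent = braid-ascent-down
    ; braid-word = ≈H-braid t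
    }
    where
    braid-ascent-down : ∀ ρ → AscentWord ρ (t ∷ suc t ∷ t ∷ []) → AscentWord ρ (suc t ∷ t ∷ suc t ∷ [])
    braid-ascent-down ρ (asc₁ , asc₂ , asc₃ , _) = ρ1+t<ρ2+t , ρ′-asc , ρ″-asc , tt
      where
      ρt<ρ2+t : ρ t < ρ (suc (suc t))
      ρt<ρ2+t = subst₂ _<_ (sortAt-ascent-suc ρ t asc₁) (sortAt-above ρ t) asc₂
      ρ1+t<ρ2+t : ρ (suc t) < ρ (suc (suc t))
      ρ1+t<ρ2+t = subst₂ _<_
        (trans (sortAt-below (sortAt ρ t) t) (sortAt-ascent-at ρ t asc₁))
        (trans (sortAt-ascent-at (sortAt ρ t) (suc t) asc₂) (sortAt-above ρ t)) asc₃
      ρ′-asc : Ascent (sortAt ρ (suc t)) t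
      ρ′-asc = subst₂ _<_ (sym (sortAt-below ρ t)) (sym (sortAt-ascent-at ρ (suc t) ρ1+t<ρ2+t)) ρt<ρ2+t
      ρ″-asc : Ascent (sortAt (sortAt ρ (suc t)) t) (suc t)
      ρ″-asc = subst₂ _<_
        (sym (trans (sortAt-ascent-suc (sortAt ρ (suc t)) t ρ′-asc) (sortAt-below ρ t)))
        (sym (trans (sortAt-above (sortAt ρ (suc t)) t) (sortAt-ascent-suc ρ (suc t) ρ1+t<ρ2+t))) asc₁

adjacentLetters : ∀ {s t} → Adjacent s t → AdjacentLetters s t
adjacentLetters (inj₁ refl) = adjacent-up _
adjacentLetters (inj₂ refl) = adjacent-down _

record Exchange (π : Seq) (r : Word) (s : ℕ) : Set where
  field
    prefix           : Word
    ≈prefix∷ʳ        : r ≈H (prefix ∷ʳ s)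
    prefix-ascending : AscentWord π prefix
    ascent-at-end    : Ascent (act π prefix) s
    act-prefix∷ʳ     : sortAt (act π prefix) s ≗ act π r
    length-prefix    : suc (length prefix) ≡ length r

open Exchange

module _ {π : Seq} where

  exchange-far : ∀ {r₀ a s} → Far a s → Ascent (act π r₀) a → Exchange π r₀ s → Exchange π (r₀ ∷ʳ a) s
  exchange-far {r₀} {a} {s} far asc E = record
    { prefix           = P ∷ʳ a
    ; ≈prefix∷ʳ        = ≈r₀∷ʳa
    ; prefix-ascending = AscentWord-∷ʳ⁺ π P (prefix-ascending E)
                           (Ascent-far⁻ τ far (Ascent-cong a (≗-sym (act-prefix∷ʳ E)) asc))
    ; ascent-at-end    = subst (λ f → Ascent f s) (sym (act-∷ʳ π P a))
                           (Ascent-far⁺ τ (Far-sym far) (ascent-at-end E))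
    ; act-prefix∷ʳ     = act-eq
    ; length-prefix    = trans (cong suc (length-∷ʳ P a)) (trans (cong suc (length-prefix E)) (sym (length-∷ʳ r₀ a)))
    }
    where
    P = prefix E
    τ = act π P
    ≈r₀∷ʳa : (r₀ ∷ʳ a) ≈H ((P ∷ʳ a) ∷ʳ s)
    ≈r₀∷ʳa = begin
      r₀ ∷ʳ a                 ≈⟨ ≈H-++ʳ [ a ] (≈prefix∷ʳ E) ⟩
      (P ∷ʳ s) ∷ʳ a           ≡⟨ ++-assoc P [ s ] [ a ] ⟩
      P ++ (s ∷ a ∷ [])       ≈⟨ ≈H-++ˡ P (≈H-comm (Far-sym far)) ⟩
      P ++ (a ∷ s ∷ [])       ≡⟨ ++-assoc P [ a ] [ s ] ⟨
      (P ∷ʳ a) ∷ʳ s           ∎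
      where open ≈H-Reasoning
    act-eq : sortAt (act π (P ∷ʳ a)) s ≗ act π (r₀ ∷ʳ a)
    act-eq = begin
      sortAt (act π (P ∷ʳ a)) s      ≡⟨ cong (λ f → sortAt f s) (act-∷ʳ π P a) ⟩
      sortAt (sortAt τ a) s          ≈⟨ sortAt-comm τ far ⟩
      sortAt (sortAt τ s) a          ≈⟨ sortAt-cong a (act-prefix∷ʳ E) ⟩
      sortAt (act π r₀) a            ≡⟨ act-∷ʳ π r₀ a ⟨
      act π (r₀ ∷ʳ a)                ∎
      where open ≗-Reasoning

  exchange-adjacent : ∀ {r₀ a s} → Adjacent s a → Ascent (act π r₀) a →
                      (E₁ : Exchange π r₀ s) → Exchange π (prefix E₁) a → Exchange π (r₀ ∷ʳ a) s
  exchange-adjacent {r₀} {a} {s} adj asc E₁ E₂ = record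
    { prefix           = P₂ ++ (s ∷ a ∷ [])
    ; ≈prefix∷ʳ        = ≈r₀∷ʳa
    ; prefix-ascending = proj₁ (AscentWord-∷ʳ⁻ π (P₂ ++ (s ∷ a ∷ [])) ascending)
    ; ascent-at-end    = proj₂ (AscentWord-∷ʳ⁻ π (P₂ ++ (s ∷ a ∷ [])) ascending)
    ; act-prefix∷ʳ     = act-eq
    ; length-prefix    = length-eq
    }
    where
    open AdjacentLetters (adjacentLetters adj)
    P₁ = prefix E₁
    P₂ = prefix E₂
    τ = act π P₁
    ρ = act π P₂
    ρa≗τ : sortAt ρ a ≗ τ
    ρa≗τ = act-prefix∷ʳ E₂
    ρas≗σ : sortAt (sortAt ρ a) s ≗ act π r₀
    ρas≗σ = ≗-trans (sortAt-cong s ρa≗τ) (act-prefix∷ʳ E₁)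
    ρ-asa : AscentWord ρ (a ∷ s ∷ a ∷ [])
    ρ-asa = ascent-at-end E₂ , Ascent-cong s (≗-sym ρa≗τ) (ascent-at-end E₁) , Ascent-cong a (≗-sym ρas≗σ) asc , tt
    ascending : AscentWord π ((P₂ ++ (s ∷ a ∷ [])) ∷ʳ s)
    ascending = subst (AscentWord π) (sym (++-assoc P₂ (s ∷ a ∷ []) [ s ]))
                  (AscentWord-++⁺ π P₂ (prefix-ascending E₂) (braid-ascent ρ ρ-asa))
    ≈r₀∷ʳa : (r₀ ∷ʳ a) ≈H ((P₂ ++ (s ∷ a ∷ [])) ∷ʳ s)
    ≈r₀∷ʳa = begin
      r₀ ∷ʳ a                        ≈⟨ ≈H-++ʳ [ a ] (≈prefix∷ʳ E₁) ⟩
      (P₁ ∷ʳ s) ∷ʳ a                 ≈⟨ ≈H-++ʳ [ a ] (≈H-++ʳ [ s ] (≈prefix∷ʳ E₂)) ⟩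
      ((P₂ ∷ʳ a) ∷ʳ s) ∷ʳ a          ≡⟨ trans (++-assoc (P₂ ∷ʳ a) [ s ] [ a ]) (++-assoc P₂ [ a ] (s ∷ a ∷ [])) ⟩
      P₂ ++ (a ∷ s ∷ a ∷ [])         ≈⟨ ≈H-++ˡ P₂ braid-word ⟩
      P₂ ++ (s ∷ a ∷ s ∷ [])         ≡⟨ ++-assoc P₂ (s ∷ a ∷ []) [ s ] ⟨
      (P₂ ++ (s ∷ a ∷ [])) ∷ʳ s      ∎
      where open ≈H-Reasoning
    act-eq : sortAt (act π (P₂ ++ (s ∷ a ∷ []))) s ≗ act π (r₀ ∷ʳ a)
    act-eq = begin
      sortAt (act π (P₂ ++ (s ∷ a ∷ []))) s  ≡⟨ cong (λ f → sortAt f s) (act-++ π P₂ (s ∷ a ∷ [])) ⟩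
      act ρ (s ∷ a ∷ s ∷ [])                 ≈⟨ braid-act ρ ⟩
      sortAt (sortAt (sortAt ρ a) s) a       ≈⟨ sortAt-cong a ρas≗σ ⟩
      sortAt (act π r₀) a                    ≡⟨ act-∷ʳ π r₀ a ⟨
      act π (r₀ ∷ʳ a)                        ∎
      where open ≗-Reasoning
    length-eq : suc (length (P₂ ++ (s ∷ a ∷ []))) ≡ length (r₀ ∷ʳ a)
    length-eq = begin
      suc (length (P₂ ++ (s ∷ a ∷ [])))  ≡⟨ cong suc (length-++ P₂) ⟩
      suc (length P₂ + 2)                ≡⟨ cong suc (+-comm (length P₂) 2) ⟩
      suc (suc (suc (length P₂)))        ≡⟨ cong (λ n → suc (suc n)) (length-prefix E₂) ⟩
      suc (suc (length P₁))              ≡⟨ cong suc (length-prefix E₁) ⟩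
      suc (length r₀)                    ≡⟨ length-∷ʳ r₀ a ⟨
      length (r₀ ∷ʳ a)                   ∎
      where open ≡-Reasoning

module _ {π : Seq} (π-increasing : Increasing π) where

  private
    exchange′ : ∀ fuel r s → length r < fuel → AscentWord π r → Descent (act π r) s → Exchange π r s
    exchange′ (suc fuel) r s r<fuel ascs desc with reverseView r
    ... | [] = ⊥-elim (<⇒≱ (π-increasing s) desc)
    ... | r₀ ∶ _ ∶ʳ a with a ≟ s | AscentWord-∷ʳ⁻ π r₀ ascs
    ...   | yes refl | ascs₀ , asc = record
      { prefix = r₀ ; ≈prefix∷ʳ = ≈H-refl ; prefix-ascending = ascs₀ ; ascent-at-end = asc
      ; act-prefix∷ʳ = cong-app (sym (act-∷ʳ π r₀ a)) ; length-prefix = sym (length-∷ʳ r₀ a) }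
    ...   | no a≢s | ascs₀ , asc = by-position (Far-or-Adjacent a s a≢s)
      where
      σ = act π r₀
      desc₀ : Descent (sortAt σ a) s
      desc₀ = subst (λ f → Descent f s) (act-∷ʳ π r₀ a) desc
      r₀<fuel : length r₀ < fuel
      r₀<fuel = ≤-pred (subst (_< suc fuel) (length-∷ʳ r₀ a) r<fuel)
      by-position : Far a s ⊎ Adjacent s a → Exchange π (r₀ ∷ʳ a) s
      by-position (inj₁ far) =
        exchange-far far asc (exchange′ fuel r₀ s r₀<fuel ascs₀ (Descent-far⁻ σ (Far-sym far) desc₀))
      by-position (inj₂ adj) =
        exchange-adjacent adj asc E₁ (exchange′ fuel (prefix E₁) a P₁<fuel (prefix-ascending E₁) τ-descent)
        where
        open AdjacentLetters (adjacentLetters adj)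
        E₁ = exchange′ fuel r₀ s r₀<fuel ascs₀ (descent-pullback σ asc desc₀)
        τ = act π (prefix E₁)
        P₁<fuel : length (prefix E₁) < fuel
        P₁<fuel = <-trans (subst (length (prefix E₁) <_) (length-prefix E₁) (n<1+n _)) r₀<fuel
        τ-descent : Descent τ a
        τ-descent = descent-pullback₂ τ (ascent-at-end E₁) (Ascent-cong a (≗-sym (act-prefix∷ʳ E₁)) asc)
                      (Descent-cong s (sortAt-cong a (≗-sym (act-prefix∷ʳ E₁))) desc₀)

  exchange : ∀ {r s} → AscentWord π r → Descent (act π r) s → Exchange π r s
  exchange {r} {s} = exchange′ (suc (length r)) r s ≤-refl

  private
    shortest : ∀ {u} → Reverse u → ∀ r → AscentWord π r → act π r ≗ act π u → length r ≤ length u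
    shortest [] r _ r≗π with reverseView r
    ... | [] = z≤n
    ... | r₀ ∶ _ ∶ʳ a = ⊥-elim (<⇒≱ (π-increasing a) (Descent-cong a r≗π (act-∷ʳ-descent π r₀ a)))
    shortest (u₀ ∶ u₀-view ∶ʳ a) r ascs r≗u with ascent? (act π u₀) a
    ... | inj₂ desc =
      ≤-trans (shortest u₀-view r ascs r≗u₀) (subst (length u₀ ≤_) (sym (length-∷ʳ u₀ a)) (n≤1+n _))
      where
      r≗u₀ : act π r ≗ act π u₀
      r≗u₀ = ≗-trans r≗u (≗-trans (cong-app (act-∷ʳ π u₀ a)) (sortAt-descent-fixed (act π u₀) a desc))
    ... | inj₁ asc =
      subst₂ _≤_ (length-prefix E) (sym (length-∷ʳ u₀ a))
        (s≤s (shortest u₀-view (prefix E) (prefix-ascending E) P≗u₀))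
      where
      u≗ : act π (u₀ ∷ʳ a) ≗ sortAt (act π u₀) a
      u≗ = cong-app (act-∷ʳ π u₀ a)
      E = exchange ascs (Descent-cong a (≗-sym (≗-trans r≗u u≗)) (sortAt-descent (act π u₀) a))
      P≗u₀ : act π (prefix E) ≗ act π u₀
      P≗u₀ = sortAt-ascent-injective _ _ a (ascent-at-end E) asc (≗-trans (act-prefix∷ʳ E) (≗-trans r≗u u≗))

  AscentWord⇒Reduced : ∀ {r} → AscentWord π r → Reduced r
  AscentWord⇒Reduced {r} ascs u r≈u = shortest (reverseView u) r ascs (act-resp-≈H π r≈u)

  descent-absorbed : ∀ {w q} → AscentWord π w → Descent (act π w) q → (w ∷ʳ q) ≈H w
  descent-absorbed {w} {q} ascs desc = begin
    w ∷ʳ q                  ≈⟨ ≈H-++ʳ [ q ] (≈prefix∷ʳ E) ⟩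
    (P ∷ʳ q) ∷ʳ q           ≡⟨ ++-assoc P [ q ] [ q ] ⟩
    P ++ (q ∷ q ∷ [])       ≈⟨ ≈H-++ˡ P (≈H-idem q) ⟩
    P ∷ʳ q                  ≈⟨ ≈H-sym (≈prefix∷ʳ E) ⟩
    w                       ∎
    where
    open ≈H-Reasoning
    E = exchange ascs desc
    P = prefix E

  -- Greedy reduction of a suffix: drop each letter that acts at a descent.
  reduce-suffix : ∀ Q w → AscentWord π w → Σ[ Q′ ∈ Word ] ((w ++ Q) ≈H (w ++ Q′)) × AscentWord π (w ++ Q′)
  reduce-suffix [] w ascs = [] , ≈H-refl , subst (AscentWord π) (sym (++-identityʳ w)) ascs
  reduce-suffix (q ∷ Q) w ascs with ascent? (act π w) q
  ... | inj₁ asc =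
    let (Q₁ , ≈Q₁ , ascs₁) = reduce-suffix Q (w ∷ʳ q) (AscentWord-∷ʳ⁺ π w ascs asc)
    in q ∷ Q₁ , ≈H-trans (≈H-reflexive (sym (++-assoc w [ q ] Q))) (≈H-trans ≈Q₁ (≈H-reflexive (++-assoc w [ q ] Q₁)))
              , subst (AscentWord π) (++-assoc w [ q ] Q₁) ascs₁
  ... | inj₂ desc =
    let (Q′ , ≈Q′ , ascs′) = reduce-suffix Q w ascs
    in Q′ , ≈H-trans (≈H-reflexive (sym (++-assoc w [ q ] Q))) (≈H-trans (≈H-++ʳ Q (descent-absorbed ascs desc)) ≈Q′)
          , ascs′

  -- Reduce w s t s greedily, then peel off its last three letters with the exchange property.
  braid-suffix : ∀ {s t} → Adjacent s t → ∀ w → AscentWord π w →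
                 Σ[ z ∈ Word ] ((w ++ (s ∷ t ∷ s ∷ [])) ≈H (z ++ (s ∷ t ∷ s ∷ [])))
                             × AscentWord π (z ++ (s ∷ t ∷ s ∷ []))
  braid-suffix {s} {t} adj w ascs =
    P₃ , ≈P₃ , AscentWord-++⁺ π P₃ (prefix-ascending E₃) (ascent-at-end E₃ , ρ₃-t , ρ₃-ts , tt)
    where
    module F = AdjacentLetters (adjacentLetters adj)
    module G = AdjacentLetters (adjacentLetters (Adjacent-sym adj))
    R = reduce-suffix (s ∷ t ∷ s ∷ []) w ascs
    v = w ++ proj₁ R
    w≈v : (w ++ (s ∷ t ∷ s ∷ [])) ≈H v
    w≈v = proj₁ (proj₂ R)
    v-desc-s : Descent (act π v) s
    v-desc-s = Descent-cong s (act-resp-≈H π w≈v)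
      (subst (λ u → Descent (act π u) s) (++-assoc w (s ∷ t ∷ []) [ s ]) (act-∷ʳ-descent π (w ++ (s ∷ t ∷ [])) s))
    v-desc-t : Descent (act π v) t
    v-desc-t = Descent-cong t (act-resp-≈H π (≈H-trans (≈H-++ˡ w F.braid-word) w≈v))
      (subst (λ u → Descent (act π u) t) (++-assoc w (t ∷ s ∷ []) [ t ]) (act-∷ʳ-descent π (w ++ (t ∷ s ∷ [])) t))
    E₁ = exchange (proj₂ (proj₂ R)) v-desc-s
    ρ₁ = act π (prefix E₁)
    E₂ = exchange (prefix-ascending E₁)
           (G.descent-pullback ρ₁ (ascent-at-end E₁) (Descent-cong t (≗-sym (act-prefix∷ʳ E₁)) v-desc-t))
    ρ₂ = act π (prefix E₂)
    ρ₂t≗ρ₁ = act-prefix∷ʳ E₂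
    E₃ = exchange (prefix-ascending E₂)
           (G.descent-pullback₂ ρ₂ (ascent-at-end E₂) (Ascent-cong s (≗-sym ρ₂t≗ρ₁) (ascent-at-end E₁))
             (Descent-cong t (≗-sym (≗-trans (sortAt-cong s ρ₂t≗ρ₁) (act-prefix∷ʳ E₁))) v-desc-t))
    P₃ = prefix E₃
    ρ₃s≗ρ₂ = act-prefix∷ʳ E₃
    ρ₃-t : Ascent (sortAt (act π P₃) s) t
    ρ₃-t = Ascent-cong t (≗-sym ρ₃s≗ρ₂) (ascent-at-end E₂)
    ρ₃-ts : Ascent (sortAt (sortAt (act π P₃) s) t) s
    ρ₃-ts = Ascent-cong s (≗-sym (≗-trans (sortAt-cong t ρ₃s≗ρ₂) ρ₂t≗ρ₁)) (ascent-at-end E₁)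
    ≈P₃ : (w ++ (s ∷ t ∷ s ∷ [])) ≈H (P₃ ++ (s ∷ t ∷ s ∷ []))
    ≈P₃ = begin
      w ++ (s ∷ t ∷ s ∷ [])          ≈⟨ w≈v ⟩
      v                              ≈⟨ ≈prefix∷ʳ E₁ ⟩
      prefix E₁ ∷ʳ s                 ≈⟨ ≈H-++ʳ [ s ] (≈prefix∷ʳ E₂) ⟩
      (prefix E₂ ∷ʳ t) ∷ʳ s          ≈⟨ ≈H-++ʳ [ s ] (≈H-++ʳ [ t ] (≈prefix∷ʳ E₃)) ⟩
      ((P₃ ∷ʳ s) ∷ʳ t) ∷ʳ s          ≡⟨ trans (++-assoc (P₃ ∷ʳ s) [ t ] [ s ]) (++-assoc P₃ [ s ] (t ∷ s ∷ [])) ⟩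
      P₃ ++ (s ∷ t ∷ s ∷ [])         ∎
      where open ≈H-Reasoning

BraidFree : Word → Set
BraidFree w = ∀ X Y {s t} → Adjacent s t → ¬ (w ≈H (X ++ (s ∷ t ∷ s ∷ []) ++ Y))

-- Reducing the parts before and after a braid factor produces a reduced word that still
-- contains it.
FullyCommutative⇒BraidFree : ∀ {x} → FullyCommutative x → BraidFree x
FullyCommutative⇒BraidFree {x} fc P Q {s} {t} adj x≈ =
  fc r x≈r (AscentWord⇒Reduced id-increasing r-asc) (r-braid adj)
  where
  id-increasing : Increasing id
  id-increasing = n<1+n
  sts = s ∷ t ∷ s ∷ []
  RP = reduce-suffix id-increasing P [] tt
  P′ = proj₁ RP
  B = braid-suffix id-increasing adj P′ (proj₂ (proj₂ RP))
  z = proj₁ B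
  RQ = reduce-suffix id-increasing Q (z ++ sts) (proj₂ (proj₂ B))
  Q′ = proj₁ RQ
  r = (z ++ sts) ++ Q′
  r-asc : AscentWord id r
  r-asc = proj₂ (proj₂ RQ)
  x≈r : x ≈H r
  x≈r = begin
    x                      ≈⟨ x≈ ⟩
    P ++ sts ++ Q          ≈⟨ ≈H-++ʳ (sts ++ Q) (proj₁ (proj₂ RP)) ⟩
    P′ ++ sts ++ Q         ≡⟨ ++-assoc P′ sts Q ⟨
    (P′ ++ sts) ++ Q       ≈⟨ ≈H-++ʳ Q (proj₁ (proj₂ B)) ⟩
    (z ++ sts) ++ Q        ≈⟨ proj₁ (proj₂ RQ) ⟩
    r                      ∎
    where open ≈H-Reasoning
  r-braid : Adjacent s t → HasBraid r
  r-braid (inj₁ refl) = z , Q′ , s , inj₁ (++-assoc z sts Q′)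
  r-braid (inj₂ refl) = z , Q′ , t , inj₂ (++-assoc z sts Q′)

BraidFree-infix : ∀ P w Q → BraidFree (P ++ w ++ Q) → BraidFree w
BraidFree-infix P w Q bf X Y {s} {t} adj w≈ = bf (P ++ X) (Y ++ Q) adj (begin
  P ++ w ++ Q                                  ≈⟨ ≈H-++ˡ P (≈H-++ʳ Q w≈) ⟩
  P ++ (X ++ sts ++ Y) ++ Q                    ≡⟨ cong (P ++_) (trans (++-assoc X _ Q) (cong (X ++_) (++-assoc sts Y Q))) ⟩
  P ++ X ++ sts ++ Y ++ Q                      ≡⟨ ++-assoc P X _ ⟨
  (P ++ X) ++ sts ++ (Y ++ Q)                  ∎)
  where
  open ≈H-Reasoning
  sts = s ∷ t ∷ s ∷ []

All-within : ∀ {P : ℕ → Set} L₁ M {L₂ L} → L ≡ L₁ ++ M ++ L₂ → (∀ {z} → z ∈ L → P z) →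
             All P L₁ × All P L₂
All-within L₁ M eq P-on-L =
  let (pL₁ , pML₂) = All.++⁻ L₁ (subst (All _) eq (All.tabulate P-on-L)) in pL₁ , All.++⁻ʳ M pML₂

bounded : ∀ L → ∃ λ N → All (_< N) L
bounded [] = 0 , []
bounded (x ∷ L) =
  let (N , L<N) = bounded L in suc x + N , m≤m+n (suc x) N ∷ All.map (λ z<N → <-≤-trans z<N (m≤n+m N (suc x))) L<N

≡ᵇ-reflects-≡ : ∀ m n → Reflects (m ≡ n) (m ≡ᵇ n)
≡ᵇ-reflects-≡ m n = fromEquivalence (≡ᵇ⇒≡ m n) (≡⇒≡ᵇ m n)

Decreasing : Word → Set
Decreasing = AllPairs (λ a b → b < a)

StrictlyDecreasing⇒Decreasing : ∀ {L} → StrictlyDecreasing L → Decreasing L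
StrictlyDecreasing⇒Decreasing = Linked⇒AllPairs (λ b<a c<b → <-trans c<b b<a)

Decreasing⇒StrictlyDecreasing : ∀ {L} → Decreasing L → StrictlyDecreasing L
Decreasing⇒StrictlyDecreasing = AllPairs⇒Linked

≢⇒T-not-≡ᵇ : ∀ {x z} → z ≢ x → T (not (z ≡ᵇ x))
≢⇒T-not-≡ᵇ {x} {z} z≢x with z ≡ᵇ x | ≡ᵇ-reflects-≡ z x
... | true  | ofʸ z≡x = z≢x z≡x
... | false | ofⁿ _   = _

T-not-≡ᵇ⇒≢ : ∀ {x z} → T (not (z ≡ᵇ x)) → z ≢ x
T-not-≡ᵇ⇒≢ {x} {z} kept z≡x with z ≡ᵇ x | ≡ᵇ-reflects-≡ z x
... | true  | _       = kept
... | false | ofⁿ z≢x = z≢x z≡x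

removeL-∷-≢ : ∀ {x y} ys → y ≢ x → removeL x (y ∷ ys) ≡ y ∷ removeL x ys
removeL-∷-≢ {x} ys y≢x = filter-accept (T? ∘ λ z → not (z ≡ᵇ x)) (≢⇒T-not-≡ᵇ y≢x)

removeL-∷-≡ : ∀ x ys → removeL x (x ∷ ys) ≡ removeL x ys
removeL-∷-≡ x ys = filter-reject (T? ∘ λ z → not (z ≡ᵇ x)) {x} {ys} (λ kept → T-not-≡ᵇ⇒≢ {x} {x} kept refl)

removeL-∉ : ∀ {x} L → x ∉ L → removeL x L ≡ L
removeL-∉ {x} L x∉L =
  filter-all (T? ∘ λ z → not (z ≡ᵇ x)) (All.tabulate (λ {z} z∈L → ≢⇒T-not-≡ᵇ {x} {z} (λ { refl → x∉L z∈L })))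

∈-removeL⁺ : ∀ {x z L} → z ∈ L → z ≢ x → z ∈ removeL x L
∈-removeL⁺ {x} z∈L z≢x = ∈-filter⁺ (T? ∘ λ z → not (z ≡ᵇ x)) z∈L (≢⇒T-not-≡ᵇ z≢x)

∈-removeL⁻ : ∀ {x z} L → z ∈ removeL x L → z ∈ L × z ≢ x
∈-removeL⁻ {x} {z} L z∈ =
  let (z∈L , kept) = ∈-filter⁻ (T? ∘ λ z → not (z ≡ᵇ x)) {xs = L} z∈ in z∈L , T-not-≡ᵇ⇒≢ {x} {z} kept

All-removeL : ∀ {P : ℕ → Set} {x L} → All P L → All P (removeL x L)
All-removeL {x = x} = All.filter⁺ (T? ∘ λ z → not (z ≡ᵇ x))

Decreasing-removeL : ∀ {x L} → Decreasing L → Decreasing (removeL x L)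
Decreasing-removeL {x} = AllPairs.filter⁺ (T? ∘ λ z → not (z ≡ᵇ x))

All-insertDec : ∀ {P : ℕ → Set} {x} L → All P L → P x → All P (insertDec x L)
All-insertDec [] [] px = px ∷ []
All-insertDec {x = x} (y ∷ ys) (py ∷ pys) px with y ≡ᵇ x | suc y ≤ᵇ x
... | true  | _     = py ∷ pys
... | false | true  = px ∷ py ∷ pys
... | false | false = py ∷ All-insertDec ys pys px

Decreasing-insertDec : ∀ {x} L → Decreasing L → Decreasing (insertDec x L)
Decreasing-insertDec [] [] = [] ∷ []
Decreasing-insertDec {x} (y ∷ ys) (ys<y ∷ dec)
  with y ≡ᵇ x | ≡ᵇ-reflects-≡ y x | suc y ≤ᵇ x | ≤ᵇ-reflects-≤ (suc y) x
... | true  | _       | _     | _        = ys<y ∷ dec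
... | false | _       | true  | ofʸ y<x  = (y<x ∷ All.map (λ z<y → <-trans z<y y<x) ys<y) ∷ ys<y ∷ dec
... | false | ofⁿ y≢x | false | ofⁿ y≮x =
  All-insertDec ys ys<y (≤∧≢⇒< (≮⇒≥ y≮x) (y≢x ∘ sym)) ∷ Decreasing-insertDec ys dec

length-insertDec : ∀ {x} L → x ∉ L → length (insertDec x L) ≡ suc (length L)
length-insertDec [] _ = refl
length-insertDec {x} (y ∷ ys) x∉ with y ≡ᵇ x | ≡ᵇ-reflects-≡ y x | suc y ≤ᵇ x
... | true  | ofʸ refl | _     = contradiction (here refl) x∉
... | false | _        | true  = refl
... | false | _        | false = cong suc (length-insertDec ys (x∉ ∘ there))

Around : ℕ → Word → Word → Set
Around x L₁ L₂ = All (x <_) L₁ × All (_< x) L₂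

around-∈ : ∀ {x L} → Decreasing L → x ∈ L → ∃₂ λ L₁ L₂ → L ≡ L₁ ++ x ∷ L₂ × Around x L₁ L₂
around-∈ {L = _ ∷ ys} (ys<x ∷ _) (here refl) = [] , ys , refl , [] , ys<x
around-∈ {L = y ∷ _} (ys<y ∷ dec) (there x∈ys) =
  let (L₁ , L₂ , eq , above , below) = around-∈ dec x∈ys
  in y ∷ L₁ , L₂ , cong (y ∷_) eq , All.lookup ys<y x∈ys ∷ above , below

around-∉ : ∀ {x L} → Decreasing L → x ∉ L → ∃₂ λ L₁ L₂ → L ≡ L₁ ++ L₂ × Around x L₁ L₂
around-∉ [] _ = [] , [] , refl , [] , []
around-∉ {x} {y ∷ ys} (ys<y ∷ dec) x∉ with <-cmp y x
... | tri< y<x _ _ = [] , y ∷ ys , refl , [] , y<x ∷ All.map (λ z<y → <-trans z<y y<x) ys<y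
... | tri≈ _ refl _ = contradiction (here refl) x∉
... | tri> _ _ x<y =
  let (L₁ , L₂ , eq , above , below) = around-∉ dec (x∉ ∘ there)
  in y ∷ L₁ , L₂ , cong (y ∷_) eq , x<y ∷ above , below

insertDec-around : ∀ {x} L₁ L₂ → Around x L₁ L₂ → insertDec x (L₁ ++ L₂) ≡ L₁ ++ x ∷ L₂
insertDec-around [] [] _ = refl
insertDec-around {x} [] (y ∷ ys) ([] , y<x ∷ _)
  with y ≡ᵇ x | ≡ᵇ-reflects-≡ y x | suc y ≤ᵇ x | ≤ᵇ-reflects-≤ (suc y) x
... | true  | ofʸ refl | _     | _        = ⊥-elim (<-irrefl refl y<x)
... | false | _        | true  | _        = refl
... | false | _        | false | ofⁿ y≮x = contradiction y<x y≮x
insertDec-around {x} (y ∷ L₁) L₂ (x<y ∷ above , below)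
  with y ≡ᵇ x | ≡ᵇ-reflects-≡ y x | suc y ≤ᵇ x | ≤ᵇ-reflects-≤ (suc y) x
... | true  | ofʸ refl | _    | _       = ⊥-elim (<-irrefl refl x<y)
... | false | _        | true | ofʸ y<x = ⊥-elim (<-asym x<y y<x)
... | false | _        | false | _      = cong (y ∷_) (insertDec-around L₁ L₂ (above , below))

removeL-around : ∀ {x} L₁ L₂ → Around x L₁ L₂ → removeL x (L₁ ++ x ∷ L₂) ≡ L₁ ++ L₂
removeL-around {x} [] L₂ (_ , below) =
  trans (removeL-∷-≡ x L₂) (removeL-∉ L₂ (λ x∈ → <-irrefl refl (All.lookup below x∈)))
removeL-around {x} (y ∷ L₁) L₂ (x<y ∷ above , below) =
  trans (removeL-∷-≢ (L₁ ++ x ∷ L₂) (>⇒≢ x<y)) (cong (y ∷_) (removeL-around L₁ L₂ (above , below)))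

length-removeL : ∀ {x L} → Decreasing L → x ∈ L → suc (length (removeL x L)) ≡ length L
length-removeL {x} dec x∈L with around-∈ dec x∈L
... | L₁ , L₂ , refl , around =
  trans (cong (suc ∘ length) (removeL-around L₁ L₂ around)) (sym (length-++-sucʳ L₁ x L₂))

∈-tail-below : ∀ {c b bs} → c ∈ b ∷ bs → c < b → c ∈ bs
∈-tail-below (here refl) c<b = ⊥-elim (<-irrefl refl c<b)
∈-tail-below (there c∈)  _   = c∈

around-∈₂ : ∀ {c L} → Decreasing L → suc c ∈ L → c ∈ L →
            ∃₂ λ L₁ L₂ → L ≡ L₁ ++ suc c ∷ c ∷ L₂ × All (suc c <_) L₁ × All (_< c) L₂
around-∈₂ {L = _ ∷ _ ∷ ws} (_ ∷ ws<w ∷ _) (here refl) (there (here refl)) = [] , ws , refl , [] , ws<w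
around-∈₂ ((w<z ∷ _) ∷ ws<w ∷ _) (here refl) (there (there c∈ws)) =
  ⊥-elim (<⇒≱ (All.lookup ws<w c∈ws) (≤-pred w<z))
around-∈₂ _ (here refl) (here c≡c+1) = ⊥-elim (n≢1+n _ c≡c+1)
around-∈₂ {L = y ∷ _} (ys<y ∷ dec) (there c+1∈ys) c∈ =
  let (L₁ , L₂ , eq , above , below) = around-∈₂ dec c+1∈ys (∈-tail-below c∈ (<-trans (n<1+n _) c+1<y))
  in y ∷ L₁ , L₂ , cong (y ∷_) eq , c+1<y ∷ above , below
  where c+1<y = All.lookup ys<y c+1∈ys

mem-reflects : ∀ x L → Reflects (x ∈ L) (mem x L)
mem-reflects x L = fromEquivalence
  (λ t → Any.map (λ {z} z≡ᵇx → sym (≡ᵇ⇒≡ z x z≡ᵇx)) (any⁻ (λ z → z ≡ᵇ x) L t))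
  (λ x∈ → any⁺ (λ z → z ≡ᵇ x) (Any.map (λ { refl → ≡⇒≡ᵇ x x refl }) x∈))

maxL-nothing : ∀ L → maxL L ≡ nothing → L ≡ []
maxL-nothing [] _ = refl
maxL-nothing (a ∷ as) eq with maxL as
maxL-nothing (a ∷ as) () | nothing
maxL-nothing (a ∷ as) () | just _

maxL-just : ∀ L {m} → maxL L ≡ just m → m ∈ L × All (_≤ m) L
maxL-just (a ∷ as) eq with maxL as in eq′
maxL-just (a ∷ as) refl | nothing rewrite maxL-nothing as eq′ = here refl , ≤-refl ∷ []
maxL-just (a ∷ as) refl | just b with maxL-just as eq′
... | b∈ , as≤b = a⊔b∈ , m≤m⊔n a b ∷ All.map (λ z≤b → ≤-trans z≤b (m≤n⊔m a b)) as≤b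
  where
  a⊔b∈ : a ⊔ b ∈ a ∷ as
  a⊔b∈ with ⊔-sel a b
  ... | inj₁ a⊔b≡a rewrite a⊔b≡a = here refl
  ... | inj₂ a⊔b≡b rewrite a⊔b≡b = there b∈

minL-nothing : ∀ L → minL L ≡ nothing → L ≡ []
minL-nothing [] _ = refl
minL-nothing (a ∷ as) eq with minL as
minL-nothing (a ∷ as) () | nothing
minL-nothing (a ∷ as) () | just _

minL-just : ∀ L {m} → minL L ≡ just m → m ∈ L × All (m ≤_) L
minL-just (a ∷ as) eq with minL as in eq′
minL-just (a ∷ as) refl | nothing rewrite minL-nothing as eq′ = here refl , ≤-refl ∷ []
minL-just (a ∷ as) refl | just b with minL-just as eq′
... | b∈ , b≤as = a⊓b∈ , m⊓n≤m a b ∷ All.map (λ b≤z → ≤-trans (m⊓n≤n a b) b≤z) b≤as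
  where
  a⊓b∈ : a ⊓ b ∈ a ∷ as
  a⊓b∈ with ⊓-sel a b
  ... | inj₁ a⊓b≡a rewrite a⊓b≡a = here refl
  ... | inj₂ a⊓b≡b rewrite a⊓b≡b = there b∈

data Partner (b : ℕ) (av : Word) : Maybe ℕ → Set where
  none : (∀ {a} → a ∈ av → a < b) → Partner b av nothing
  some : ∀ {m} → m ∈ av → b ≤ m → (∀ {a} → a ∈ av → b ≤ a → m ≤ a) → Partner b av (just m)

partner : ∀ b av → Partner b av (minL (filterᵇ (λ a → b ≤ᵇ a) av))
partner b av with minL (filterᵇ (λ a → b ≤ᵇ a) av) in eq
... | nothing = none (λ {a} a∈ → ≰⇒> (λ b≤a →
      ¬Any[] (subst (a ∈_) (minL-nothing _ eq) (∈-filter⁺ (T? ∘ λ a → b ≤ᵇ a) a∈ (≤⇒≤ᵇ b≤a)))))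
... | just m with minL-just _ eq
...   | m∈ , m≤ with ∈-filter⁻ (T? ∘ λ a → b ≤ᵇ a) {xs = av} m∈
...     | m∈av , b≤ᵇm =
  some m∈av (≤ᵇ⇒≤ b m b≤ᵇm) λ a∈ b≤a →
    All.lookup m≤ (∈-filter⁺ (T? ∘ λ a → b ≤ᵇ a) a∈ (≤⇒≤ᵇ b≤a))

-- The pairing consumes A while it runs through B, so these lemmas are stated for an arbitrary
-- pool av of letters still available.
unpairedA⊆ : ∀ B av {z} → z ∈ unpairedA B av → z ∈ av
unpairedA⊆ [] av z∈ = z∈
unpairedA⊆ (b ∷ bs) av z∈ with minL (filterᵇ (λ a → b ≤ᵇ a) av) | partner b av
... | nothing | _ = unpairedA⊆ bs av z∈
... | just m  | _ = proj₁ (∈-removeL⁻ av (unpairedA⊆ bs (removeL m av) z∈))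

unpairedB⊆ : ∀ B av {z} → z ∈ unpairedB B av → z ∈ B
unpairedB⊆ (b ∷ bs) av z∈ with minL (filterᵇ (λ a → b ≤ᵇ a) av) | partner b av
unpairedB⊆ (b ∷ bs) av (here refl) | nothing | _ = here refl
unpairedB⊆ (b ∷ bs) av (there z∈)  | nothing | _ = there (unpairedB⊆ bs av z∈)
... | just m | _ = there (unpairedB⊆ bs (removeL m av) z∈)

unpairedA∉ : ∀ B av {x} → x ∈ unpairedA B av → x ∉ B
unpairedA∉ (b ∷ bs) av x∈ x∈B with minL (filterᵇ (λ a → b ≤ᵇ a) av) | partner b av | x∈B
... | nothing | none below | here refl = <-irrefl refl (below (unpairedA⊆ bs av x∈))
... | nothing | none _     | there x∈bs = unpairedA∉ bs av x∈ x∈bs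
... | just m  | some _ b≤m least | here refl =
  let (x∈av , x≢m) = ∈-removeL⁻ av (unpairedA⊆ bs (removeL m av) x∈)
  in x≢m (≤-antisym b≤m (least x∈av ≤-refl))
... | just m  | some _ _ _ | there x∈bs = unpairedA∉ bs (removeL m av) x∈ x∈bs

unpairedB∉ : ∀ {B} av {y} → Decreasing B → y ∈ unpairedB B av → y ∉ av
unpairedB∉ {b ∷ bs} av (bs<b ∷ dec) y∈ y∈av with minL (filterᵇ (λ a → b ≤ᵇ a) av) | partner b av | y∈
... | nothing | none below | here refl = <-irrefl refl (below y∈av)
... | nothing | none _     | there y∈′ = unpairedB∉ av dec y∈′ y∈av
... | just m  | some _ b≤m _ | y∈′ =
  unpairedB∉ (removeL m av) dec y∈′
    (∈-removeL⁺ y∈av (<⇒≢ (<-≤-trans (All.lookup bs<b (unpairedB⊆ bs _ y∈′)) b≤m)))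

paired-by-between : ∀ B av {x a} → x ∈ unpairedA B av → a ∈ av → a ∉ unpairedA B av → x < a →
                    ∃ λ b → b ∈ B × x < b × b ≤ a
paired-by-between [] av _ a∈ a∉ _ = contradiction a∈ a∉
paired-by-between (b ∷ bs) av {x} {a} x∈ a∈ a∉ x<a with minL (filterᵇ (λ a → b ≤ᵇ a) av) | partner b av
... | nothing | _ =
  let (b′ , b′∈ , x<b′ , b′≤a) = paired-by-between bs av x∈ a∈ a∉ x<a in b′ , there b′∈ , x<b′ , b′≤a
... | just m | some _ b≤m least with a ≟ m
...   | yes refl = b , here refl , ≰⇒> (λ b≤x → <⇒≱ x<a (least x∈av b≤x)) , b≤m
  where x∈av = proj₁ (∈-removeL⁻ av (unpairedA⊆ bs (removeL m av) x∈))
...   | no a≢m =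
  let (b′ , b′∈ , x<b′ , b′≤a) = paired-by-between bs (removeL m av) x∈ (∈-removeL⁺ a∈ a≢m) a∉ x<a
  in b′ , there b′∈ , x<b′ , b′≤a

Covered : Word → Word → ℕ → ℕ → Set
Covered av B c y = ∀ d → c < d → d < y → d ∉ av ⊎ d ∈ B

Covered-∷ : ∀ {av av′ b bs c y} → (∀ {d} → d ∈ av′ → d ∈ av) → b ∉ av′ ⊎ y ≤ b →
            Covered av (b ∷ bs) c y → Covered av′ bs c y
Covered-∷ ⊆av b-out cov d c<d d<y with cov d c<d d<y
... | inj₁ d∉av       = inj₁ (d∉av ∘ ⊆av)
... | inj₂ (there d∈) = inj₂ d∈
... | inj₂ (here refl) with b-out
...   | inj₁ b∉av′ = inj₁ b∉av′
...   | inj₂ y≤b   = ⊥-elim (<⇒≱ d<y y≤b)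

private
  partner-removed : ∀ {b av m} → b ≤ m → (∀ {a} → a ∈ av → b ≤ a → m ≤ a) → b ∉ removeL m av
  partner-removed {av = av} b≤m least b∈ =
    let (b∈av , b≢m) = ∈-removeL⁻ av b∈ in b≢m (≤-antisym b≤m (least b∈av ≤-refl))

  removeL⊆ : ∀ {m} av {d} → d ∈ removeL m av → d ∈ av
  removeL⊆ av = proj₁ ∘ ∈-removeL⁻ av

covered-below-unpairedA : ∀ {B} av {x c} → Decreasing B → x ∈ unpairedA B av → c ∈ B → c < x →
                          Covered av B c x → c ∈ av
covered-below-unpairedA {b ∷ bs} av {x} (bs<b ∷ dec) x∈ c∈ c<x cov
  with minL (filterᵇ (λ a → b ≤ᵇ a) av) | partner b av | c∈
... | nothing | none below | here refl = ⊥-elim (<⇒≱ (below (unpairedA⊆ bs av x∈)) (<⇒≤ c<x))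
... | nothing | none below | there c∈bs =
  covered-below-unpairedA av dec x∈ c∈bs c<x (Covered-∷ id (inj₁ (λ b∈ → <-irrefl refl (below b∈))) cov)
... | just m | some m∈ b≤m least | here refl with m ≟ b
...   | yes refl = m∈
...   | no m≢b with cov m (≤∧≢⇒< b≤m (m≢b ∘ sym)) (≤∧≢⇒< (least x∈av (<⇒≤ c<x)) (x≢m ∘ sym))
  where
  x∈av = proj₁ (∈-removeL⁻ av (unpairedA⊆ bs (removeL m av) x∈))
  x≢m = proj₂ (∈-removeL⁻ av (unpairedA⊆ bs (removeL m av) x∈))
...     | inj₁ m∉av = contradiction m∈ m∉av
...     | inj₂ (here m≡b) = ⊥-elim (m≢b m≡b)
...     | inj₂ (there m∈bs) = ⊥-elim (<⇒≱ (All.lookup bs<b m∈bs) b≤m)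
covered-below-unpairedA {b ∷ bs} av {x} (bs<b ∷ dec) x∈ c∈ c<x cov
  | just m | some m∈ b≤m least | there c∈bs =
  removeL⊆ av (covered-below-unpairedA (removeL m av) dec x∈ c∈bs c<x
    (Covered-∷ (removeL⊆ av) (inj₁ (partner-removed b≤m least)) cov))

unpairedB-above : ∀ {B} av {y d} → Decreasing B → y ∈ unpairedB B av → d ∈ av → y < d →
                  (∀ z → y < z → z < d → z ∈ B → z ∈ av) → d ∈ B
unpairedB-above {b ∷ bs} av {y} {d} (bs<b ∷ dec) y∈ d∈ y<d between with d ≟ b
... | yes refl = here refl
... | no d≢b with minL (filterᵇ (λ a → b ≤ᵇ a) av) | partner b av | y∈
...   | nothing | none below | here refl = ⊥-elim (<-asym y<d (below d∈))
...   | nothing | none _     | there y∈′ =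
  there (unpairedB-above av dec y∈′ d∈ y<d (λ z y<z z<d z∈ → between z y<z z<d (there z∈)))
...   | just m  | some _ b≤m least | y∈′ with d ≟ m
...     | yes refl = ⊥-elim (<⇒≱ b<d (least (between b y<b b<d (here refl)) ≤-refl))
  where
  y<b = All.lookup bs<b (unpairedB⊆ bs (removeL d av) y∈′)
  b<d = ≤∧≢⇒< b≤m (d≢b ∘ sym)
...     | no d≢m = there (unpairedB-above (removeL m av) dec y∈′ (∈-removeL⁺ d∈ d≢m) y<d λ z y<z z<d z∈ →
            ∈-removeL⁺ (between z y<z z<d (there z∈)) (<⇒≢ (<-≤-trans (All.lookup bs<b z∈) b≤m)))

private
  paired-below-bound : ∀ {B} av {y c} → Decreasing B → c ∈ B → c ∉ unpairedB B av → c < y →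
                       (∀ {a} → a ∈ av → a < y) → Covered av B c y → c ∈ av
  paired-below-bound {b ∷ bs} av (bs<b ∷ dec) c∈ c∉ c<y below-y cov
    with minL (filterᵇ (λ a → b ≤ᵇ a) av) | partner b av | c∈
  ... | nothing | none _     | here refl  = contradiction (here refl) c∉
  ... | nothing | none below | there c∈bs =
    paired-below-bound av dec c∈bs (c∉ ∘ there) c<y below-y
      (Covered-∷ id (inj₁ (λ b∈ → <-irrefl refl (below b∈))) cov)
  ... | just m | some m∈ b≤m _ | here refl with m ≟ b
  ...   | yes refl = m∈
  ...   | no m≢b with cov m (≤∧≢⇒< b≤m (m≢b ∘ sym)) (below-y m∈)
  ...     | inj₁ m∉av         = contradiction m∈ m∉av
  ...     | inj₂ (here m≡b)   = ⊥-elim (m≢b m≡b)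
  ...     | inj₂ (there m∈bs) = ⊥-elim (<⇒≱ (All.lookup bs<b m∈bs) b≤m)
  paired-below-bound {b ∷ bs} av (bs<b ∷ dec) c∈ c∉ c<y below-y cov
    | just m | some m∈ b≤m least | there c∈bs =
    removeL⊆ av (paired-below-bound (removeL m av) dec c∈bs c∉ c<y (below-y ∘ removeL⊆ av)
      (Covered-∷ (removeL⊆ av) (inj₁ (partner-removed b≤m least)) cov))

covered-below-unpairedB : ∀ {B} av {y c} → Decreasing B → y ∈ unpairedB B av → c ∈ B → c < y →
                          c ∉ unpairedB B av → Covered av B c y → c ∈ av
covered-below-unpairedB {b ∷ bs} av {y} (bs<b ∷ dec) y∈ c∈ c<y c∉ cov
  with minL (filterᵇ (λ a → b ≤ᵇ a) av) | partner b av | y∈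
... | nothing | none below | here refl =
  paired-below-bound av dec (∈-tail-below c∈ c<y) (c∉ ∘ there) c<y below
    (Covered-∷ id (inj₁ (λ b∈ → <-irrefl refl (below b∈))) cov)
... | nothing | none _ | there y∈′ =
  covered-below-unpairedB av dec y∈′ (∈-tail-below c∈ (<-trans c<y y<b)) c<y (c∉ ∘ there)
    (Covered-∷ id (inj₂ (<⇒≤ y<b)) cov)
  where y<b = All.lookup bs<b (unpairedB⊆ bs av y∈′)
... | just m | some _ _ _ | y∈′ =
  removeL⊆ av (covered-below-unpairedB (removeL m av) dec y∈′ (∈-tail-below c∈ (<-trans c<y y<b)) c<y c∉
    (Covered-∷ (removeL⊆ av) (inj₂ (<⇒≤ y<b)) cov))
  where y<b = All.lookup bs<b (unpairedB⊆ bs (removeL m av) y∈′)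

-- Moving one letter between adjacent factors

regroup : ∀ (B₁ M B₂ A₁ R : Word) → (B₁ ++ M ++ B₂) ++ (A₁ ++ R) ≡ B₁ ++ M ++ (B₂ ++ A₁) ++ R
regroup B₁ M B₂ A₁ R = begin
  (B₁ ++ M ++ B₂) ++ (A₁ ++ R)    ≡⟨ ++-assoc B₁ (M ++ B₂) (A₁ ++ R) ⟩
  B₁ ++ (M ++ B₂) ++ (A₁ ++ R)    ≡⟨ cong (B₁ ++_) (++-assoc M B₂ (A₁ ++ R)) ⟩
  B₁ ++ M ++ B₂ ++ (A₁ ++ R)      ≡⟨ cong (λ w → B₁ ++ M ++ w) (++-assoc B₂ A₁ R) ⟨
  B₁ ++ M ++ (B₂ ++ A₁) ++ R      ∎
  where open ≡-Reasoning

braid-right⊥ : ∀ {c} U W V → All (Far c) W → ¬ BraidFree (U ++ c ∷ W ++ suc c ∷ c ∷ V)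
braid-right⊥ {c} U W V far bf =
  bf (U ++ W) V (inj₁ refl) (begin
    U ++ c ∷ W ++ suc c ∷ c ∷ V             ≈⟨ ≈H-++ˡ U (≈H-commutes-past W (suc c ∷ c ∷ V) far) ⟩
    U ++ W ++ c ∷ suc c ∷ c ∷ V             ≡⟨ ++-assoc U W _ ⟨
    (U ++ W) ++ (c ∷ suc c ∷ c ∷ []) ++ V   ∎)
  where open ≈H-Reasoning

braid-left⊥ : ∀ {e} U W V → All (Far (suc e)) W → ¬ BraidFree (U ++ suc e ∷ e ∷ W ++ suc e ∷ V)
braid-left⊥ {e} U W V far bf =
  bf U (W ++ V) (inj₂ refl)
    (≈H-++ˡ U (≈H-∷ (suc e) (≈H-∷ e (≈H-sym (≈H-commutes-past W V far)))))

cross : ∀ {x} B₁ B₂ A₁ A₂ → All (Far x) (B₂ ++ A₁) →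
        ((B₁ ++ B₂) ++ (A₁ ++ x ∷ A₂)) ≈H ((B₁ ++ x ∷ B₂) ++ (A₁ ++ A₂))
cross {x} B₁ B₂ A₁ A₂ far = begin
  (B₁ ++ B₂) ++ (A₁ ++ x ∷ A₂)     ≡⟨ regroup B₁ [] B₂ A₁ (x ∷ A₂) ⟩
  B₁ ++ (B₂ ++ A₁) ++ x ∷ A₂       ≈⟨ ≈H-++ˡ B₁ (≈H-sym (≈H-commutes-past (B₂ ++ A₁) A₂ far)) ⟩
  B₁ ++ x ∷ (B₂ ++ A₁) ++ A₂       ≡⟨ regroup B₁ [ x ] B₂ A₁ A₂ ⟨
  (B₁ ++ x ∷ B₂) ++ (A₁ ++ A₂)     ∎
  where open ≈H-Reasoning

cross-pair : ∀ {x} B₁ W A₂ → All (Far x) W → All (Far (suc x)) W →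
             (B₁ ++ suc x ∷ W ++ suc x ∷ x ∷ A₂) ≈H (B₁ ++ suc x ∷ x ∷ W ++ x ∷ A₂)
cross-pair {x} B₁ W A₂ far far′ = ≈H-++ˡ B₁ (begin
  suc x ∷ W ++ suc x ∷ x ∷ A₂       ≈⟨ ≈H-∷ (suc x) (≈H-sym (≈H-commutes-past W (x ∷ A₂) far′)) ⟩
  suc x ∷ suc x ∷ W ++ x ∷ A₂       ≈⟨ ≈H-∷ (suc x) (≈H-∷ (suc x) (≈H-sym (≈H-commutes-past W A₂ far))) ⟩
  suc x ∷ suc x ∷ x ∷ W ++ A₂       ≈⟨ ≈H-++ʳ (x ∷ W ++ A₂) (≈H-idem (suc x)) ⟩
  suc x ∷ x ∷ W ++ A₂               ≈⟨ ≈H-∷ (suc x) (≈H-++ʳ (W ++ A₂) (≈H-idem x)) ⟨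
  suc x ∷ x ∷ x ∷ W ++ A₂           ≈⟨ ≈H-∷ (suc x) (≈H-∷ x (≈H-commutes-past W A₂ far)) ⟩
  suc x ∷ x ∷ W ++ x ∷ A₂           ∎)
  where open ≈H-Reasoning

record PairMove (B A B′ A′ : Word) : Set₁ where
  field
    ≈H-moved     : (B ++ A) ≈H (B′ ++ A′)
    length-moved : length (B′ ++ A′) ≡ length (B ++ A)
    decreasing₁  : Decreasing B′
    decreasing₂  : Decreasing A′
    letters      : ∀ {P : ℕ → Set} → All P B → All P A → All P B′ × All P A′

move-to-left : ∀ {B A x r} → Decreasing B → Decreasing A → x ∉ B → x ∈ A → r ∈ A →
               (B ++ A) ≈H (insertDec x B ++ removeL r A) → PairMove B A (insertDec x B) (removeL r A)
move-to-left {B} {A} {x} {r} decB decA x∉B x∈A r∈A ≈moved = record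
  { ≈H-moved     = ≈moved
  ; length-moved = begin
      length (insertDec x B ++ removeL r A)        ≡⟨ length-++ (insertDec x B) ⟩
      length (insertDec x B) + length (removeL r A) ≡⟨ cong (_+ _) (length-insertDec B x∉B) ⟩
      suc (length B) + length (removeL r A)        ≡⟨ +-suc (length B) _ ⟨
      length B + suc (length (removeL r A))        ≡⟨ cong (length B +_) (length-removeL decA r∈A) ⟩
      length B + length A                          ≡⟨ length-++ B ⟨
      length (B ++ A)                              ∎
  ; decreasing₁  = Decreasing-insertDec B decB
  ; decreasing₂  = Decreasing-removeL decA
  ; letters      = λ pB pA → All-insertDec B pB (All.lookup pA x∈A) , All-removeL pA
  }
  where open ≡-Reasoning

move-to-right : ∀ {B A y r} → Decreasing B → Decreasing A → y ∉ A → y ∈ B → r ∈ B →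
                (B ++ A) ≈H (removeL r B ++ insertDec y A) → PairMove B A (removeL r B) (insertDec y A)
move-to-right {B} {A} {y} {r} decB decA y∉A y∈B r∈B ≈moved = record
  { ≈H-moved     = ≈moved
  ; length-moved = begin
      length (removeL r B ++ insertDec y A)         ≡⟨ length-++ (removeL r B) ⟩
      length (removeL r B) + length (insertDec y A) ≡⟨ cong (length (removeL r B) +_) (length-insertDec A y∉A) ⟩
      length (removeL r B) + suc (length A)         ≡⟨ +-suc _ (length A) ⟩
      suc (length (removeL r B)) + length A         ≡⟨ cong (_+ length A) (length-removeL decB r∈B) ⟩
      length B + length A                           ≡⟨ length-++ B ⟨
      length (B ++ A)                               ∎
  ; decreasing₁  = Decreasing-removeL decB
  ; decreasing₂  = Decreasing-insertDec A decA
  ; letters      = λ pB pA → All-removeL pB , All-insertDec A pA (All.lookup pB y∈B)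
  }
  where open ≡-Reasoning

Run : Word → ℕ → ℕ → Set
Run B c t = ∀ d → c ≤ d → d < t → d ∈ B

module _ {B A : Word} (decB : Decreasing B) (decA : Decreasing A) (posB : All (1 ≤_) B)
         (bf : BraidFree (B ++ A)) where

  no-braid-down : ∀ {c} → c ∈ B → (∀ {z} → z ∈ B → suc z ≢ c) → c ∈ A → suc c ∉ A
  no-braid-down {c} c∈B no-pred c∈A c+1∈A with around-∈ decB c∈B | around-∈₂ decA c+1∈A c∈A
  ... | B₁ , B₂ , eqB , _ , B₂<c | A₁ , A₃ , eqA , c+1<A₁ , _ =
    braid-right⊥ B₁ (B₂ ++ A₁) A₃ far
      (subst BraidFree (trans (cong₂ _++_ eqB eqA) (regroup B₁ [ c ] B₂ A₁ (suc c ∷ c ∷ A₃))) bf)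
    where
    far : All (Far c) (B₂ ++ A₁)
    far = All.++⁺ (All-Far-below B₂<c (proj₂ (All-within B₁ [ c ] eqB no-pred))) (All.map inj₁ c+1<A₁)

  no-braid-up : ∀ {e} → suc e ∈ B → e ∈ B → suc e ∈ A → ¬ (suc (suc e) ∉ A)
  no-braid-up {e} e+1∈B e∈B e+1∈A e+2∉A with around-∈₂ decB e+1∈B e∈B | around-∈ decA e+1∈A
  ... | B₁ , B₂ , eqB , _ , B₂<e | A₁ , A₂ , eqA , e+1<A₁ , _ =
    braid-left⊥ B₁ (B₂ ++ A₁) A₂ far
      (subst BraidFree (trans (cong₂ _++_ eqB eqA) (regroup B₁ (suc e ∷ e ∷ []) B₂ A₁ (suc e ∷ A₂))) bf)
    where
    far : All (Far (suc e)) (B₂ ++ A₁)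
    far = All.++⁺ (All.map (λ z<e → inj₂ (s≤s z<e)) B₂<e)
                  (All-Far-above e+1<A₁ (proj₁ (All-within A₁ [ suc e ] eqA λ z∈A z≡e+2 →
                    e+2∉A (subst (_∈ A) z≡e+2 z∈A))))

  -- Walking down a run of B whose letters are forced into A produces the braid c (c+1) c.
  descending-run⊥ : ∀ {t} → (∀ {c} → c < t → Run B c t → c ∈ A) → ∀ c → Run B c t → c < t → suc c ∉ A
  descending-run⊥ forced zero run 0<t _ = <-irrefl refl (All.lookup posB (run 0 z≤n 0<t))
  descending-run⊥ forced (suc c) run c+1<t c+2∈A with c ∈? B
  ... | yes c∈B = descending-run⊥ forced c run′ (<-trans (n<1+n c) c+1<t) (forced c+1<t run)
    where
    run′ : Run B c _
    run′ d c≤d d<t with d ≟ c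
    ... | yes refl = c∈B
    ... | no d≢c = run d (≤∧≢⇒< c≤d (d≢c ∘ sym)) d<t
  ... | no c∉B = no-braid-down (run (suc c) ≤-refl c+1<t)
                   (λ z∈B 1+z≡1+c → c∉B (subst (_∈ B) (suc-injective 1+z≡1+c) z∈B)) (forced c+1<t run) c+2∈A

  predecessor-absent : ∀ {x} → x ∈ A → (∀ {c} → c < x → Run B c x → c ∈ A) → ∀ {z} → z ∈ B → suc z ≢ x
  predecessor-absent x∈A forced {z} z∈B refl =
    descending-run⊥ forced z (λ d z≤d d<1+z → subst (_∈ B) (≤-antisym z≤d (≤-pred d<1+z)) z∈B) (n<1+n z) x∈A

  -- Walking up a run of A ∩ B whose letters are forced into B produces the braid (e+1) e (e+1).
  ascending-run⊥ : ∀ {y} → y ∈ B →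
                   (∀ {d} → d ∈ A → y < d → (∀ z → y < z → z < d → z ∈ B → z ∈ A) → d ∈ B) →
                   ∀ k d → All (_< d + k) A → y < d → (∀ z → y < z → z ≤ d → z ∈ A × z ∈ B) → ⊥
  ascending-run⊥ {y} y∈B forced k (suc e) bound y<e+1 run with suc (suc e) ∈? A | k
  ... | no e+2∉A | _ = no-braid-up (proj₂ (run (suc e) y<e+1 ≤-refl)) e∈B (proj₁ (run (suc e) y<e+1 ≤-refl)) e+2∉A
    where
    e∈B : e ∈ B
    e∈B with e ≟ y
    ... | yes refl = y∈B
    ... | no e≢y = proj₂ (run e (≤∧≢⇒< (≤-pred y<e+1) (e≢y ∘ sym)) (n≤1+n e))
  ... | yes e+2∈A | zero = <-asym (n<1+n (suc e)) (subst (suc (suc e) <_) (+-identityʳ (suc e)) (All.lookup bound e+2∈A))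
  ... | yes e+2∈A | suc k′ =
    ascending-run⊥ y∈B forced k′ (suc (suc e)) (subst (λ N → All (_< N) A) (+-suc (suc e) k′) bound)
      (<-trans y<e+1 (n<1+n _)) run′
    where
    e+2∈B : suc (suc e) ∈ B
    e+2∈B = forced e+2∈A (<-trans y<e+1 (n<1+n _)) (λ z y<z z<e+2 _ → proj₁ (run z y<z (≤-pred z<e+2)))
    run′ : ∀ z → y < z → z ≤ suc (suc e) → z ∈ A × z ∈ B
    run′ z y<z z≤e+2 with z ≟ suc (suc e)
    ... | yes refl = e+2∈A , e+2∈B
    ... | no z≢e+2 = run z y<z (≤-pred (≤∧≢⇒< z≤e+2 z≢e+2))

  module _ {x} (x∈ : x ∈ unpairedA B A) (x-max : All (_≤ x) (unpairedA B A)) where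

    private
      x∈A : x ∈ A
      x∈A = unpairedA⊆ B A x∈

      x∉B : x ∉ B
      x∉B = unpairedA∉ B A x∈

      x+1∈A⇒x+1∈B : suc x ∈ A → suc x ∈ B
      x+1∈A⇒x+1∈B x+1∈A =
        let (b , b∈B , x<b , b≤x+1) = paired-by-between B A x∈ x+1∈A (1+n≰n ∘ All.lookup x-max) (n<1+n x)
        in subst (_∈ B) (≤-antisym b≤x+1 x<b) b∈B

      predecessor∉B : ∀ {z} → z ∈ B → suc z ≢ x
      predecessor∉B = predecessor-absent x∈A (λ c<x run →
        covered-below-unpairedA A decB x∈ (run _ ≤-refl c<x) c<x (λ d c<d d<x → inj₂ (run d (<⇒≤ c<d) d<x)))

    f-move-single : ¬ (suc x ∈ A × suc x ∈ B) → PairMove B A (insertDec x B) (removeL x A)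
    f-move-single not-both with around-∉ decB x∉B | around-∈ decA x∈A
    ... | B₁ , B₂ , eqB , x<B₁ , B₂<x | A₁ , A₂ , eqA , x<A₁ , A₂<x =
      move-to-left decB decA x∉B x∈A x∈A ≈moved
      where
      insert-eq : insertDec x B ≡ B₁ ++ x ∷ B₂
      insert-eq = trans (cong (insertDec x) eqB) (insertDec-around B₁ B₂ (x<B₁ , B₂<x))
      remove-eq : removeL x A ≡ A₁ ++ A₂
      remove-eq = trans (cong (removeL x) eqA) (removeL-around A₁ A₂ (x<A₁ , A₂<x))
      far-B₂ : All (Far x) B₂
      far-B₂ = All-Far-below B₂<x (proj₂ (All-within B₁ [] eqB predecessor∉B))
      far-A₁ : All (Far x) A₁
      far-A₁ = All-Far-above x<A₁ (proj₁ (All-within A₁ [ x ] eqA λ z∈A z≡x+1 →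
        let x+1∈A = subst (_∈ A) z≡x+1 z∈A in not-both (x+1∈A , x+1∈A⇒x+1∈B x+1∈A)))
      ≈moved : (B ++ A) ≈H (insertDec x B ++ removeL x A)
      ≈moved = begin
        B ++ A                          ≡⟨ cong₂ _++_ eqB eqA ⟩
        (B₁ ++ B₂) ++ (A₁ ++ x ∷ A₂)    ≈⟨ cross B₁ B₂ A₁ A₂ (All.++⁺ far-B₂ far-A₁) ⟩
        (B₁ ++ x ∷ B₂) ++ (A₁ ++ A₂)    ≡⟨ cong₂ _++_ insert-eq remove-eq ⟨
        insertDec x B ++ removeL x A    ∎
        where open ≈H-Reasoning

    f-move-pair : suc x ∈ A → suc x ∈ B → PairMove B A (insertDec x B) (removeL (suc x) A)
    f-move-pair x+1∈A x+1∈B with around-∈ decB x+1∈B | around-∈₂ decA x+1∈A x∈A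
    ... | Bh , Bt , eqB , x+1<Bh , Bt<x+1 | Ah , At , eqA , x+1<Ah , At<x =
      move-to-left decB decA x∉B x∈A x+1∈A ≈moved
      where
      W = Bt ++ Ah
      Bt<x : All (_< x) Bt
      Bt<x = All.zipWith (λ (z<x+1 , z≢x) → ≤∧≢⇒< (≤-pred z<x+1) z≢x)
               (Bt<x+1 , proj₂ (All-within Bh [ suc x ] eqB λ z∈B z≡x → x∉B (subst (_∈ B) z≡x z∈B)))
      x+2∉A : suc (suc x) ∉ A
      x+2∉A = no-braid-down x+1∈B (λ z∈B 1+z≡1+x → x∉B (subst (_∈ B) (suc-injective 1+z≡1+x) z∈B)) x+1∈A
      far-x : All (Far x) W
      far-x = All.++⁺ (All-Far-below Bt<x (proj₂ (All-within Bh [ suc x ] eqB predecessor∉B))) (All.map inj₁ x+1<Ah)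
      far-x+1 : All (Far (suc x)) W
      far-x+1 = All.++⁺ (All.map (λ z<x → inj₂ (s≤s z<x)) Bt<x)
        (All-Far-above x+1<Ah (proj₁ (All-within Ah (suc x ∷ x ∷ []) eqA λ z∈A z≡x+2 →
          x+2∉A (subst (_∈ A) z≡x+2 z∈A))))
      insert-eq : insertDec x B ≡ Bh ++ suc x ∷ x ∷ Bt
      insert-eq = begin
        insertDec x B                         ≡⟨ cong (insertDec x) (trans eqB (sym (++-assoc Bh [ suc x ] Bt))) ⟩
        insertDec x ((Bh ∷ʳ suc x) ++ Bt)     ≡⟨ insertDec-around (Bh ∷ʳ suc x) Bt (x<Bh∷ʳx+1 , Bt<x) ⟩
        (Bh ∷ʳ suc x) ++ x ∷ Bt               ≡⟨ ++-assoc Bh [ suc x ] (x ∷ Bt) ⟩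
        Bh ++ suc x ∷ x ∷ Bt                  ∎
        where
        open ≡-Reasoning
        x<Bh∷ʳx+1 = All.++⁺ (All.map (<-trans (n<1+n x)) x+1<Bh) (n<1+n x ∷ [])
      remove-eq : removeL (suc x) A ≡ Ah ++ x ∷ At
      remove-eq = trans (cong (removeL (suc x)) eqA)
        (removeL-around Ah (x ∷ At) (x+1<Ah , n<1+n x ∷ All.map (λ z<x → <-trans z<x (n<1+n x)) At<x))
      ≈moved : (B ++ A) ≈H (insertDec x B ++ removeL (suc x) A)
      ≈moved = begin
        B ++ A                                        ≡⟨ cong₂ _++_ eqB eqA ⟩
        (Bh ++ suc x ∷ Bt) ++ (Ah ++ suc x ∷ x ∷ At)  ≡⟨ regroup Bh [ suc x ] Bt Ah (suc x ∷ x ∷ At) ⟩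
        Bh ++ suc x ∷ W ++ suc x ∷ x ∷ At             ≈⟨ cross-pair Bh W At far-x far-x+1 ⟩
        Bh ++ suc x ∷ x ∷ W ++ x ∷ At                 ≡⟨ regroup Bh (suc x ∷ x ∷ []) Bt Ah (x ∷ At) ⟨
        (Bh ++ suc x ∷ x ∷ Bt) ++ (Ah ++ x ∷ At)      ≡⟨ cong₂ _++_ insert-eq remove-eq ⟨
        insertDec x B ++ removeL (suc x) A            ∎
        where open ≈H-Reasoning

  forced-below-unpairedB : ∀ {y} → y ∈ unpairedB B A → All (y ≤_) (unpairedB B A) →
                           ∀ {c} → c < y → Run B c y → c ∈ A
  forced-below-unpairedB y∈ y-min c<y run =
    covered-below-unpairedB A decB y∈ (run _ ≤-refl c<y) c<y (λ c∈ → <⇒≱ c<y (All.lookup y-min c∈))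
      (λ d c<d d<y → inj₂ (run d (<⇒≤ c<d) d<y))

  successor-unpairedB∉ : ∀ {y} → y ∈ unpairedB B A → suc y ∉ A
  successor-unpairedB∉ {y} y∈ y+1∈A =
    ascending-run⊥ (unpairedB⊆ B A y∈) forced N (suc y) (All.map (λ z<N → <-≤-trans z<N (m≤n+m N (suc y))) bound)
      (n<1+n y) run
    where
    N = proj₁ (bounded A)
    bound = proj₂ (bounded A)
    forced : ∀ {d} → d ∈ A → y < d → (∀ z → y < z → z < d → z ∈ B → z ∈ A) → d ∈ B
    forced = unpairedB-above A decB y∈
    run : ∀ z → y < z → z ≤ suc y → z ∈ A × z ∈ B
    run z y<z z≤y+1 with ≤-antisym z≤y+1 y<z
    ... | refl = y+1∈A , forced y+1∈A (n<1+n y) (λ z y<z z<y+1 _ → ⊥-elim (<⇒≱ y<z (≤-pred z<y+1)))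

  e-move-single : ∀ {y} → y ∈ unpairedB B A → All (y ≤_) (unpairedB B A) → ¬ (y ∸ 1 ∈ A × y ∸ 1 ∈ B) →
                  PairMove B A (removeL y B) (insertDec y A)
  e-move-single {y} y∈ y-min not-both with around-∈ decB (unpairedB⊆ B A y∈) | around-∉ decA (unpairedB∉ A decB y∈)
  ... | B₁ , B₂ , eqB , y<B₁ , B₂<y | A₁ , A₂ , eqA , y<A₁ , A₂<y =
    move-to-right decB decA (unpairedB∉ A decB y∈) (unpairedB⊆ B A y∈) (unpairedB⊆ B A y∈) ≈moved
    where
    predecessor∉B : ∀ {z} → z ∈ B → suc z ≢ y
    predecessor∉B {z} z∈B refl = not-both (forced-below-unpairedB y∈ y-min (n<1+n z) run , z∈B)
      where
      run : Run B z (suc z)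
      run d z≤d d<1+z = subst (_∈ B) (≤-antisym z≤d (≤-pred d<1+z)) z∈B
    far-B₂ : All (Far y) B₂
    far-B₂ = All-Far-below B₂<y (proj₂ (All-within B₁ [ y ] eqB predecessor∉B))
    far-A₁ : All (Far y) A₁
    far-A₁ = All-Far-above y<A₁ (proj₁ (All-within A₁ [] eqA λ z∈A z≡y+1 →
      successor-unpairedB∉ y∈ (subst (_∈ A) z≡y+1 z∈A)))
    remove-eq : removeL y B ≡ B₁ ++ B₂
    remove-eq = trans (cong (removeL y) eqB) (removeL-around B₁ B₂ (y<B₁ , B₂<y))
    insert-eq : insertDec y A ≡ A₁ ++ y ∷ A₂
    insert-eq = trans (cong (insertDec y) eqA) (insertDec-around A₁ A₂ (y<A₁ , A₂<y))
    ≈moved : (B ++ A) ≈H (removeL y B ++ insertDec y A)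
    ≈moved = begin
      B ++ A                          ≡⟨ cong₂ _++_ eqB eqA ⟩
      (B₁ ++ y ∷ B₂) ++ (A₁ ++ A₂)    ≈⟨ ≈H-sym (cross B₁ B₂ A₁ A₂ (All.++⁺ far-B₂ far-A₁)) ⟩
      (B₁ ++ B₂) ++ (A₁ ++ y ∷ A₂)    ≡⟨ cong₂ _++_ remove-eq insert-eq ⟨
      removeL y B ++ insertDec y A    ∎
      where open ≈H-Reasoning

  e-move-pair : ∀ {y} → y ∈ unpairedB B A → All (y ≤_) (unpairedB B A) → y ∸ 1 ∈ A → y ∸ 1 ∈ B →
                PairMove B A (removeL (y ∸ 1) B) (insertDec y A)
  e-move-pair {zero} y∈ _ _ _ = ⊥-elim (<-irrefl refl (All.lookup posB (unpairedB⊆ B A y∈)))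
  e-move-pair {suc c} y∈ y-min c∈A c∈B with around-∈₂ decB (unpairedB⊆ B A y∈) c∈B | around-∈ decA c∈A
  ... | Bh , Bt , eqB , c+1<Bh , Bt<c | A₁ , A₃ , eqA , c<A₁ , A₃<c =
    move-to-right decB decA c+1∉A (unpairedB⊆ B A y∈) c∈B ≈moved
    where
    c+1∉A : suc c ∉ A
    c+1∉A = unpairedB∉ A decB y∈
    W = Bt ++ A₁
    c+1<A₁ : All (suc c <_) A₁
    c+1<A₁ = All.zipWith (λ (c<z , z≢c+1) → ≤∧≢⇒< c<z (z≢c+1 ∘ sym))
               (c<A₁ , proj₁ (All-within A₁ [ c ] eqA λ z∈A z≡c+1 → c+1∉A (subst (_∈ A) z≡c+1 z∈A)))
    predecessor∉B : ∀ {z} → z ∈ B → suc z ≢ c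
    predecessor∉B = predecessor-absent c∈A λ {c′} c′<c run →
      forced-below-unpairedB y∈ y-min (<-trans c′<c (n<1+n c)) λ d c′≤d d<c+1 → case d ≟ c of λ where
        (yes refl) → c∈B
        (no d≢c)   → run d c′≤d (≤∧≢⇒< (≤-pred d<c+1) d≢c)
    far-c : All (Far c) W
    far-c = All.++⁺ (All-Far-below Bt<c (proj₂ (All-within Bh (suc c ∷ c ∷ []) eqB predecessor∉B))) (All.map inj₁ c+1<A₁)
    far-c+1 : All (Far (suc c)) W
    far-c+1 = All.++⁺ (All.map (λ z<c → inj₂ (s≤s z<c)) Bt<c)
      (All-Far-above c+1<A₁ (proj₁ (All-within A₁ [ c ] eqA λ z∈A z≡c+2 →
        successor-unpairedB∉ y∈ (subst (_∈ A) z≡c+2 z∈A))))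
    remove-eq : removeL c B ≡ Bh ++ suc c ∷ Bt
    remove-eq = begin
      removeL c B                         ≡⟨ cong (removeL c) (trans eqB (sym (++-assoc Bh [ suc c ] (c ∷ Bt)))) ⟩
      removeL c ((Bh ∷ʳ suc c) ++ c ∷ Bt) ≡⟨ removeL-around (Bh ∷ʳ suc c) Bt (c<Bh∷ʳc+1 , Bt<c) ⟩
      (Bh ∷ʳ suc c) ++ Bt                 ≡⟨ ++-assoc Bh [ suc c ] Bt ⟩
      Bh ++ suc c ∷ Bt                    ∎
      where
      open ≡-Reasoning
      c<Bh∷ʳc+1 = All.++⁺ (All.map (<-trans (n<1+n c)) c+1<Bh) (n<1+n c ∷ [])
    insert-eq : insertDec (suc c) A ≡ A₁ ++ suc c ∷ c ∷ A₃
    insert-eq = trans (cong (insertDec (suc c)) eqA)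
      (insertDec-around A₁ (c ∷ A₃) (c+1<A₁ , n<1+n c ∷ All.map (λ z<c → <-trans z<c (n<1+n c)) A₃<c))
    ≈moved : (B ++ A) ≈H (removeL c B ++ insertDec (suc c) A)
    ≈moved = begin
      B ++ A                                        ≡⟨ cong₂ _++_ eqB eqA ⟩
      (Bh ++ suc c ∷ c ∷ Bt) ++ (A₁ ++ c ∷ A₃)      ≡⟨ regroup Bh (suc c ∷ c ∷ []) Bt A₁ (c ∷ A₃) ⟩
      Bh ++ suc c ∷ c ∷ W ++ c ∷ A₃                 ≈⟨ ≈H-sym (cross-pair Bh W A₃ far-c far-c+1) ⟩
      Bh ++ suc c ∷ W ++ suc c ∷ c ∷ A₃             ≡⟨ regroup Bh [ suc c ] Bt A₁ (suc c ∷ c ∷ A₃) ⟨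
      (Bh ++ suc c ∷ Bt) ++ (A₁ ++ suc c ∷ c ∷ A₃)  ≡⟨ cong₂ _++_ remove-eq insert-eq ⟨
      removeL c B ++ insertDec (suc c) A            ∎
      where open ≈H-Reasoning

  move-cast : ∀ {B′ A′ B″ A″} → just (B′ , A′) ≡ just (B″ , A″) →
              PairMove B A B′ A′ → PairMove B A B″ A″
  move-cast refl move = move

  f-move : ∀ {B′ A′} → fPair B A ≡ just (B′ , A′) → PairMove B A B′ A′
  f-move eq with maxL (unpairedA B A) in eq-max
  f-move () | nothing
  ... | just x with maxL-just (unpairedA B A) eq-max
                  | mem (suc x) A ∧ mem (suc x) B | mem-reflects (suc x) A ×-reflects mem-reflects (suc x) B
  ...   | x∈ , x-max | true  | ofʸ (x+1∈A , x+1∈B) = move-cast eq (f-move-pair x∈ x-max x+1∈A x+1∈B)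
  ...   | x∈ , x-max | false | ofⁿ not-both        = move-cast eq (f-move-single x∈ x-max not-both)

  e-move : ∀ {B′ A′} → ePair B A ≡ just (B′ , A′) → PairMove B A B′ A′
  e-move eq with minL (unpairedB B A) in eq-min
  e-move () | nothing
  ... | just y with minL-just (unpairedB B A) eq-min
                  | mem (y ∸ 1) A ∧ mem (y ∸ 1) B | mem-reflects (y ∸ 1) A ×-reflects mem-reflects (y ∸ 1) B
  ...   | y∈ , y-min | true  | ofʸ (c∈A , c∈B) = move-cast eq (e-move-pair y∈ y-min c∈A c∈B)
  ...   | y∈ , y-min | false | ofⁿ not-both    = move-cast eq (e-move-single y∈ y-min not-both)

IsLength-resp-≈H : ∀ {w w′ k} → w ≈H w′ → IsLength w k → IsLength w′ k
IsLength-resp-≈H w≈w′ ((v , w≈v , length-v) , minimal) =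
  (v , ≈H-trans (≈H-sym w≈w′) w≈v , length-v) , λ u w′≈u → minimal u (≈H-trans w≈w′ w′≈u)

getV-setV : ∀ {m} p q w (h : Vec Word m) → p ≢ q → getV p (setV q w h) ≡ getV p h
getV-setV p       q       w []ᵛ       _   = refl
getV-setV zero    zero    w (_ ∷ᵛ _) p≢q = ⊥-elim (p≢q refl)
getV-setV zero    (suc q) w (_ ∷ᵛ _) _   = refl
getV-setV (suc p) zero    w (_ ∷ᵛ _) _   = refl
getV-setV (suc p) (suc q) w (_ ∷ᵛ h) p≢q = getV-setV p q w h (λ p≡q → p≢q (cong suc p≡q))

adjacent-pair : ∀ {m} (h : Vec Word m) k → suc k < m →
  ∃₂ λ L₁ L₂ → toList h ≡ L₁ ++ getV k h ∷ getV (suc k) h ∷ L₂ ×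
               (∀ A′ B′ → toList (setV (suc k) B′ (setV k A′ h)) ≡ L₁ ++ A′ ∷ B′ ∷ L₂)
adjacent-pair (x ∷ᵛ y ∷ᵛ h) zero _ = [] , toList h , refl , λ _ _ → refl
adjacent-pair (x ∷ᵛ h) (suc k) (s≤s k+1<m) =
  let (L₁ , L₂ , eq , eq′) = adjacent-pair h k k+1<m
  in x ∷ L₁ , L₂ , cong (x ∷_) eq , λ A′ B′ → cong (x ∷_) (eq′ A′ B′)

concat-around : ∀ (R₂ R₁ : List Word) A B → concat ((R₂ ++ B ∷ A ∷ []) ++ R₁) ≡ concat R₂ ++ (B ++ A) ++ concat R₁
concat-around []       R₁ A B = sym (++-assoc B A (concat R₁))
concat-around (r ∷ R₂) R₁ A B = trans (cong (r ++_) (concat-around R₂ R₁ A B)) (sym (++-assoc r (concat R₂) _))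

concat-reverse-pair : ∀ (L₁ L₂ : List Word) A B →
  concat (reverse (L₁ ++ A ∷ B ∷ L₂)) ≡ concat (reverse L₂) ++ (B ++ A) ++ concat (reverse L₁)
concat-reverse-pair L₁ L₂ A B = begin
  concat (reverse (L₁ ++ A ∷ B ∷ L₂))                   ≡⟨ cong concat (reverse-++ L₁ (A ∷ B ∷ L₂)) ⟩
  concat (reverse ((A ∷ B ∷ []) ++ L₂) ++ reverse L₁)    ≡⟨ cong (λ R → concat (R ++ reverse L₁)) (reverse-++ (A ∷ B ∷ []) L₂) ⟩
  concat ((reverse L₂ ++ B ∷ A ∷ []) ++ reverse L₁)      ≡⟨ concat-around (reverse L₂) (reverse L₁) A B ⟩
  concat (reverse L₂) ++ (B ++ A) ++ concat (reverse L₁) ∎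
  where open ≡-Reasoning

applyAt-just : ∀ op i {m} (h : Fact m) {h″} → applyAt op i h ≡ just h″ →
  ∃₂ λ B′ A′ → op (factor (suc i) h) (factor i h) ≡ just (B′ , A′) × h″ ≡ setV i B′ (setV (i ∸ 1) A′ h)
applyAt-just op i h eq with op (factor (suc i) h) (factor i h)
applyAt-just op i h () | nothing
applyAt-just op i h refl | just (B′ , A′) = B′ , A′ , refl , refl

length-infix : ∀ (P : Word) {w w′ : Word} (Q : Word) → length w ≡ length w′ →
               length (P ++ w ++ Q) ≡ length (P ++ w′ ++ Q)
length-infix []      {w} {w′} Q eq = trans (length-++ w) (trans (cong (_+ length Q) eq) (sym (length-++ w′)))
length-infix (_ ∷ P) Q eq = cong suc (length-infix P Q eq)

module FactorPair {n m : ℕ} (h : Fact m) (h∈ : InHStar n m h) (k : ℕ) (k+1<m : suc k < m) where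

  private
    A = getV k h
    B = getV (suc k) h
    L₁ = proj₁ (adjacent-pair h k k+1<m)
    L₂ = proj₁ (proj₂ (adjacent-pair h k k+1<m))
    P = concat (reverse L₂)
    Q = concat (reverse L₁)
    h′ : Word → Word → Fact m
    h′ B′ A′ = setV (suc k) B′ (setV k A′ h)

    toList-h : toList h ≡ L₁ ++ A ∷ B ∷ L₂
    toList-h = proj₁ (proj₂ (proj₂ (adjacent-pair h k k+1<m)))

    toList-h′ : ∀ B′ A′ → toList (h′ B′ A′) ≡ L₁ ++ A′ ∷ B′ ∷ L₂
    toList-h′ B′ A′ = proj₂ (proj₂ (proj₂ (adjacent-pair h k k+1<m))) A′ B′

    word-h : word h ≡ P ++ (B ++ A) ++ Q
    word-h = trans (cong (λ L → concat (reverse L)) toList-h) (concat-reverse-pair L₁ L₂ A B)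

    word-h′ : ∀ B′ A′ → word (h′ B′ A′) ≡ P ++ (B′ ++ A′) ++ Q
    word-h′ B′ A′ = trans (cong (λ L → concat (reverse L)) (toList-h′ B′ A′)) (concat-reverse-pair L₁ L₂ A′ B′)

    GoodFactor : Word → Set
    GoodFactor f = StrictlyDecreasing f × All (Letter n) f

    good-factors : All GoodFactor L₁ × All GoodFactor (A ∷ B ∷ L₂)
    good-factors = All.++⁻ L₁ (subst (All GoodFactor) toList-h (proj₁ h∈))

    good-A : GoodFactor A
    good-A = All.head (proj₂ good-factors)

    good-B : GoodFactor B
    good-B = All.head (All.tail (proj₂ good-factors))

  decreasing-A : Decreasing A
  decreasing-A = StrictlyDecreasing⇒Decreasing (proj₁ good-A)

  decreasing-B : Decreasing B
  decreasing-B = StrictlyDecreasing⇒Decreasing (proj₁ good-B)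

  positive-B : All (1 ≤_) B
  positive-B = All.map proj₁ (proj₂ good-B)

  BraidFree-pair : BraidFree (B ++ A)
  BraidFree-pair = BraidFree-infix P (B ++ A) Q (subst BraidFree word-h (FullyCommutative⇒BraidFree (proj₂ h∈)))

  move-conclusion : ∀ {B′ A′} → PairMove B A B′ A′ → Conclusion n m (suc k) h (h′ B′ A′)
  move-conclusion {B′} {A′} move =
    (factors-good , λ v → proj₂ h∈ v ∘ ≈H-trans word-h≈) , word-h′≈ , same-excess , untouched
    where
    open PairMove move
    word-h′≈ : word (h′ B′ A′) ≈H word h
    word-h′≈ = begin
      word (h′ B′ A′)          ≡⟨ word-h′ B′ A′ ⟩
      P ++ (B′ ++ A′) ++ Q     ≈⟨ ≈H-++ˡ P (≈H-++ʳ Q (≈H-sym ≈H-moved)) ⟩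
      P ++ (B ++ A) ++ Q       ≡⟨ word-h ⟨
      word h                   ∎
      where open ≈H-Reasoning
    word-h≈ : word h ≈H word (h′ B′ A′)
    word-h≈ = ≈H-sym word-h′≈
    factors-good : All GoodFactor (toList (h′ B′ A′))
    factors-good = subst (All GoodFactor) (sym (toList-h′ B′ A′)) (All.++⁺ (proj₁ good-factors)
      ((Decreasing⇒StrictlyDecreasing decreasing₂ , proj₂ new-letters) ∷
       (Decreasing⇒StrictlyDecreasing decreasing₁ , proj₁ new-letters) ∷ All.tail (All.tail (proj₂ good-factors))))
      where new-letters = letters (proj₂ good-B) (proj₂ good-A)
    same-total : total (h′ B′ A′) ≡ total h
    same-total = trans (cong length (word-h′ B′ A′))
      (trans (length-infix P {B′ ++ A′} {B ++ A} Q length-moved) (sym (cong length word-h)))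
    same-excess : ∀ e → HasExcess (h′ B′ A′) e ⇔ HasExcess h e
    same-excess e = mk⇔
      (λ (ℓ , is-ℓ , total≡) → ℓ , IsLength-resp-≈H word-h′≈ is-ℓ , trans (sym same-total) total≡)
      (λ (ℓ , is-ℓ , total≡) → ℓ , IsLength-resp-≈H word-h≈ is-ℓ , trans same-total total≡)
    untouched : ∀ j → 1 ≤ j → j ≤ m → j ≢ suc k → j ≢ suc (suc k) → factor j (h′ B′ A′) ≡ factor j h
    untouched (suc j) _ _ j+1≢k+1 j+1≢k+2 =
      trans (getV-setV j (suc k) B′ (setV k A′ h) (j+1≢k+2 ∘ cong suc)) (getV-setV j k A′ h (j+1≢k+1 ∘ cong suc))

  operator-conclusion : (op : Word → Word → Maybe (Word × Word)) →
                        (∀ {B′ A′} → op B A ≡ just (B′ , A′) → PairMove B A B′ A′) →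
                        ∀ h″ → applyAt op (suc k) h ≡ just h″ → Conclusion n m (suc k) h h″
  operator-conclusion op move h″ eq with applyAt-just op (suc k) h eq
  ... | B′ , A′ , eq-op , refl = move-conclusion (move eq-op)

proposition2p7 : (n m : ℕ) → 1 ≤ n → 2 ≤ m → (h : Fact m) → InHStar n m h →
                 (i : ℕ) → 1 ≤ i → i < m →
                 (∀ h' → fStar i h ≡ just h' → Conclusion n m i h h') ×
                 (∀ h' → eStar i h ≡ just h' → Conclusion n m i h h')
proposition2p7 n m _ _ h h∈ (suc k) _ k+1<m =
  operator-conclusion fPair (f-move decreasing-B decreasing-A positive-B BraidFree-pair) ,
  operator-conclusion ePair (e-move decreasing-B decreasing-A positive-B BraidFree-pair)
  where open FactorPair {n} h h∈ k k+1<m
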